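{- Let $R,T$ be structures and $a$ a name. (1) $\vdash_{\mathsf{BVQ}}\langle R;T\rangle$ iff $\vdash_{\mathsf{BVQ}}R$ and $\vdash_{\mathsf{BVQ}}T$. (2) $\vdash_{\mathsf{BVQ}}(R;T)$ iff $\vdash_{\mathsf{BVQ}}R$ and $\vdash_{\mathsf{BVQ}}T$. (3) $\vdash_{\mathsf{BVQ}}\mathsf{Sdq}\,a.R$ iff $\vdash_{\mathsf{BVQ}}R\{b/a\}$ for every name $b$.
   Context: Fix a countably infinite set of names $a,b,c,\dots$. Structures are generated by $R ::= \circ \mid a \mid \bar a \mid [R;R] \mid (R;R) \mid \langle R;R\rangle \mid \mathsf{Sdq}\,a.R$ (unit, atom, negated atom, Par, Copar, Seq, self-dual quantifier binding $a$ in $R$). $\mathrm{fn}(R)$ denotes the free names of $R$; $R\{b/a\}$ is capture-avoiding replacement of free occurrences of $a$ (in $a$ and $\bar a$) by $b$. Structures are considered modulo $\approx$, the least congruence such that Par, Copar, Seq are associative, Par and Copar commutative, $\circ$ a unit for Par, Copar and Seq, $\mathsf{Sdq}\,a.R\approx R$ if $a\notin\mathrm{fn}(R)$, $\mathsf{Sdq}\,a.R\approx\mathsf{Sdq}\,b.R\{b/a\}$ if $b\notin\mathrm{fn}(R)$, and $\mathsf{Sdq}\,a.\mathsf{Sdq}\,b.R\approx\mathsf{Sdq}\,b.\mathsf{Sdq}\,a.R$. Rules of $\mathsf{BVQ}$ (premise $\Longrightarrow$ conclusion, in any one-hole context $S\{\ \}$): $\mathsf{ai}{\downarrow}$: $S\{\circ\}\Longrightarrow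 S[a;\bar a]$; $\mathsf{s}$: $S([R;U];T)\Longrightarrow S[(R;T);U]$; $\mathsf{q}{\downarrow}$: $S\langle[R;U];[T;V]\rangle\Longrightarrow S[\langle R;T\rangle;\langle U;V\rangle]$; $\mathsf{u}{\downarrow}$: $S\{\mathsf{Sdq}\,a.[R;U]\}\Longrightarrow S[\mathsf{Sdq}\,a.R;\mathsf{Sdq}\,a.U]$. $\vdash_{\mathsf{BVQ}}R$ means there is a finite sequence of rule instances of $\mathsf{BVQ}$ leading from $\circ$ to $R$ modulo $\approx$ (a proof of $R$). -}

module Defs where

open import Data.Nat using (ℕ; suc; _⊔_; _≟_)
open import Data.Bool using (if_then_else_)
open import Relation.Nullary using (¬_; does)
open import Relation.Binary.PropositionalEquality using (_≡_; _≢_)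

Name : Set
Name = ℕ

-- Structures of BVQ (named-binder syntax; α-equivalence is part of _≈_).
data Str : Set where
  ∘    : Str
  at   : Name → Str
  neg  : Name → Str
  par  : Str → Str → Str     -- [R;T]
  copar : Str → Str → Str    -- (R;T)
  seq  : Str → Str → Str     -- ⟨R;T⟩
  sdq  : Name → Str → Str    -- Sdq a.R  (binds a in R)

data _∈fn_ (a : Name) : Str → Set where
  fn-at    : a ∈fn at a
  fn-neg   : a ∈fn neg a
  fn-parˡ  : ∀ {R T} → a ∈fn R → a ∈fn par R T
  fn-parʳ  : ∀ {R T} → a ∈fn T → a ∈fn par R T
  fn-coparˡ : ∀ {R T} → a ∈fn R → a ∈fn copar R T
  fn-coparʳ : ∀ {R T} → a ∈fn T → a ∈fn copar R T
  fn-seqˡ  : ∀ {R T} → a ∈fn R → a ∈fn seq R T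
  fn-seqʳ  : ∀ {R T} → a ∈fn T → a ∈fn seq R T
  fn-sdq   : ∀ {c R} → a ≢ c → a ∈fn R → a ∈fn sdq c R

_∉fn_ : Name → Str → Set
a ∉fn R = ¬ (a ∈fn R)

maxName : (Name → Name) → Str → ℕ
maxName σ ∘ = 0
maxName σ (at a) = σ a
maxName σ (neg a) = σ a
maxName σ (par R T) = maxName σ R ⊔ maxName σ T
maxName σ (copar R T) = maxName σ R ⊔ maxName σ T
maxName σ (seq R T) = maxName σ R ⊔ maxName σ T
maxName σ (sdq c R) = σ c ⊔ maxName σ R

update : (Name → Name) → Name → Name → (Name → Name)
update σ c c' n = if does (n ≟ c) then c' else σ n

-- Capture-avoiding renaming of free names by σ. Each binder is renamed to a
-- name strictly larger than σ of every name of its body, hence no capture.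
rename : (Name → Name) → Str → Str
rename σ ∘ = ∘
rename σ (at a) = at (σ a)
rename σ (neg a) = neg (σ a)
rename σ (par R T) = par (rename σ R) (rename σ T)
rename σ (copar R T) = copar (rename σ R) (rename σ T)
rename σ (seq R T) = seq (rename σ R) (rename σ T)
rename σ (sdq c R) =
  let c' = suc (maxName σ R) in sdq c' (rename (update σ c c') R)

_[_/_] : Str → Name → Name → Str
R [ b / a ] = rename (λ n → if does (n ≟ a) then b else n) R

infix 4 _≈_
data _≈_ : Str → Str → Set where
  ≈-refl  : ∀ {R} → R ≈ R
  ≈-sym   : ∀ {R T} → R ≈ T → T ≈ R
  ≈-trans : ∀ {R T U} → R ≈ T → T ≈ U → R ≈ U
  par-cong   : ∀ {R R' T T'} → R ≈ R' → T ≈ T' → par R T ≈ par R' T'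
  copar-cong : ∀ {R R' T T'} → R ≈ R' → T ≈ T' → copar R T ≈ copar R' T'
  seq-cong   : ∀ {R R' T T'} → R ≈ R' → T ≈ T' → seq R T ≈ seq R' T'
  sdq-cong   : ∀ {a R R'} → R ≈ R' → sdq a R ≈ sdq a R'
  par-assoc   : ∀ {R T U} → par (par R T) U ≈ par R (par T U)
  copar-assoc : ∀ {R T U} → copar (copar R T) U ≈ copar R (copar T U)
  seq-assoc   : ∀ {R T U} → seq (seq R T) U ≈ seq R (seq T U)
  par-comm   : ∀ {R T} → par R T ≈ par T R
  copar-comm : ∀ {R T} → copar R T ≈ copar T R
  par-unitˡ   : ∀ {R} → par ∘ R ≈ R
  par-unitʳ   : ∀ {R} → par R ∘ ≈ R
  copar-unitˡ : ∀ {R} → copar ∘ R ≈ R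
  copar-unitʳ : ∀ {R} → copar R ∘ ≈ R
  seq-unitˡ   : ∀ {R} → seq ∘ R ≈ R
  seq-unitʳ   : ∀ {R} → seq R ∘ ≈ R
  sdq-vac   : ∀ {a R} → a ∉fn R → sdq a R ≈ R
  sdq-alpha : ∀ {a b R} → b ∉fn R → sdq a R ≈ sdq b (R [ b / a ])
  sdq-swap  : ∀ {a b R} → sdq a (sdq b R) ≈ sdq b (sdq a R)

data Ctx : Set where
  hole    : Ctx
  parˡ    : Ctx → Str → Ctx
  parʳ    : Str → Ctx → Ctx
  coparˡ  : Ctx → Str → Ctx
  coparʳ  : Str → Ctx → Ctx
  seqˡ    : Ctx → Str → Ctx
  seqʳ    : Str → Ctx → Ctx
  sdqᶜ    : Name → Ctx → Ctx

plug : Ctx → Str → Str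
plug hole R = R
plug (parˡ S T) R = par (plug S R) T
plug (parʳ T S) R = par T (plug S R)
plug (coparˡ S T) R = copar (plug S R) T
plug (coparʳ T S) R = copar T (plug S R)
plug (seqˡ S T) R = seq (plug S R) T
plug (seqʳ T S) R = seq T (plug S R)
plug (sdqᶜ a S) R = sdq a (plug S R)

-- Rule instances (premise, conclusion) without context.
data Rule : Str → Str → Set where
  ai↓ : ∀ a → Rule ∘ (par (at a) (neg a))
  s   : ∀ R T U → Rule (copar (par R U) T) (par (copar R T) U)
  q↓  : ∀ R T U V → Rule (seq (par R U) (par T V)) (par (seq R T) (seq U V))
  u↓  : ∀ a R U → Rule (sdq a (par R U)) (par (sdq a R) (sdq a U))

data ⊢BVQ : Str → Set where
  ax   : ⊢BVQ ∘
  ≈-step : ∀ {P Q} → ⊢BVQ P → P ≈ Q → ⊢BVQ Q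
  rule : ∀ {P Q} (S : Ctx) → ⊢BVQ (plug S P) → Rule P Q → ⊢BVQ (plug S Q)

-- The "if" directions are easy: a derivation can be replayed inside any context
-- (⊢-plug), and Sdq a.R is α-equivalent to Sdq b.R{b/a} for a fresh b.
--
-- The "only if" directions all follow from one projection lemma (⊢-project).
-- Annotate a structure by colouring every atom kept/erased and every quantifier
-- kept/instantiated.  Its projection along a name f deletes the erased atoms and
-- replaces each instantiated quantifier Sdq a.X by X{f/a}.  If the annotation is
-- consistent (no par mixes a kept with an erased atom, and no instantiated
-- quantifier over atoms stands in a par next to atoms) and f is fresh for the
-- whole derivation, then the projection of a provable structure is provable.
-- The proof runs backwards through the derivation: each ≈-equation and each rule
-- instance turns a consistent annotation of its conclusion into one of its
-- premise whose projection is ≈-equal, respectively one rule step below.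
--
-- Renaming is treated through the relation `Renaming σ X Y`, which leaves the
-- choice of bound names free; it shows that rename respects ≈ and that
-- provability is closed under renaming.  Finally ⟨R;T⟩ and (R;T) project onto R
-- and T by erasing the other side, and Sdq a.R projects onto R{f/a}, which then
-- renames to any R{b/a}.
module Submission where

open import Defs
open import Data.Product using (_×_; _,_; proj₁; Σ-syntax; swap)
open import Function.Bundles using (_⇔_; mk⇔)
open import Data.Nat using (ℕ; suc; _⊔_; _≤_; _<_; _≟_; s≤s)
open import Data.Nat.Properties
  using (≤-refl; ≤-trans; m≤m⊔n; m≤n⊔m; n≤1+n; <-irrefl; <⇒≢; m⊔n<o⇒m<o; m⊔n<o⇒n<o)
open import Data.Bool using (Bool; true; false; _∨_; _∧_; if_then_else_)
open import Data.Bool.Properties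
  using (∨-conicalˡ; ∨-conicalʳ; ∨-comm; ∨-assoc; ∨-identityʳ)
open import Data.Sum using (_⊎_; inj₁; inj₂; map₁)
open import Data.Empty using (⊥-elim)
open import Data.Unit using (⊤; tt)
open import Relation.Nullary using (¬_; yes; no; does)
open import Relation.Nullary.Decidable using (dec-true; dec-false)
open import Relation.Binary.PropositionalEquality
  using (_≡_; _≢_; refl; sym; trans; cong; cong₂; subst; subst₂)
open Relation.Binary.PropositionalEquality.≡-Reasoning

infixr 9 _∘ᶠ_
_∘ᶠ_ : (Name → Name) → (Name → Name) → (Name → Name)
(τ ∘ᶠ σ) n = τ (σ n)

idᶠ : Name → Name
idᶠ n = n

replace : Name → Name → Name → Name
replace b a n = if does (n ≟ a) then b else n

update-≡ : ∀ (σ : Name → Name) c c' → update σ c c' c ≡ c'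
update-≡ σ c c' rewrite dec-true (c ≟ c) refl = refl

update-≢ : ∀ (σ : Name → Name) {c} c' {n} → n ≢ c → update σ c c' n ≡ σ n
update-≢ σ {c} c' {n} n≢c rewrite dec-false (n ≟ c) n≢c = refl

replace-≡ : ∀ b a → replace b a a ≡ b
replace-≡ b a rewrite dec-true (a ≟ a) refl = refl

replace-≢ : ∀ b a {n} → n ≢ a → replace b a n ≡ n
replace-≢ b a {n} n≢a rewrite dec-false (n ≟ a) n≢a = refl

Agree : (Name → Name) → (Name → Name) → Str → Set
Agree σ τ X = ∀ n → n ∈fn X → σ n ≡ τ n

≤⇒≢suc : ∀ {m k} → m ≤ k → m ≢ suc k
≤⇒≢suc m≤k = <⇒≢ (s≤s m≤k)

≤⇒≢suc² : ∀ {m k} → m ≤ k → m ≢ suc (suc k)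
≤⇒≢suc² {k = k} m≤k = <⇒≢ (s≤s (≤-trans m≤k (n≤1+n k)))

maxName-fn : ∀ σ {n} X → n ∈fn X → σ n ≤ maxName σ X
maxName-fn σ (at a) fn-at = ≤-refl
maxName-fn σ (neg a) fn-neg = ≤-refl
maxName-fn σ (par R T) (fn-parˡ p) = ≤-trans (maxName-fn σ R p) (m≤m⊔n _ _)
maxName-fn σ (par R T) (fn-parʳ p) = ≤-trans (maxName-fn σ T p) (m≤n⊔m _ _)
maxName-fn σ (copar R T) (fn-coparˡ p) = ≤-trans (maxName-fn σ R p) (m≤m⊔n _ _)
maxName-fn σ (copar R T) (fn-coparʳ p) = ≤-trans (maxName-fn σ T p) (m≤n⊔m _ _)
maxName-fn σ (seq R T) (fn-seqˡ p) = ≤-trans (maxName-fn σ R p) (m≤m⊔n _ _)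
maxName-fn σ (seq R T) (fn-seqʳ p) = ≤-trans (maxName-fn σ T p) (m≤n⊔m _ _)
maxName-fn σ (sdq c R) (fn-sdq _ p) = ≤-trans (maxName-fn σ R p) (m≤n⊔m _ _)

maxN : Str → ℕ
maxN = maxName idᶠ

fresh-above : ∀ {f} X → maxN X < f → f ∉fn X
fresh-above X lt p = <-irrefl refl (≤-trans (s≤s (maxName-fn idᶠ X p)) lt)

-- Unlike `rename`, the new bound names are arbitrary, so the relation is closed
-- under the operations below; `rename` is one particular renaming.
data Renaming : (Name → Name) → Str → Str → Set where
  ren-∘     : ∀ {σ} → Renaming σ ∘ ∘
  ren-at    : ∀ {σ a} → Renaming σ (at a) (at (σ a))
  ren-neg   : ∀ {σ a} → Renaming σ (neg a) (neg (σ a))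
  ren-par   : ∀ {σ R T R' T'} → Renaming σ R R' → Renaming σ T T' → Renaming σ (par R T) (par R' T')
  ren-copar : ∀ {σ R T R' T'} → Renaming σ R R' → Renaming σ T T' → Renaming σ (copar R T) (copar R' T')
  ren-seq   : ∀ {σ R T R' T'} → Renaming σ R R' → Renaming σ T T' → Renaming σ (seq R T) (seq R' T')
  ren-sdq   : ∀ {σ c c' R R'} → (∀ n → n ∈fn R → n ≢ c → σ n ≢ c') →
              Renaming (update σ c c') R R' → Renaming σ (sdq c R) (sdq c' R')

rename-renaming : ∀ σ X → Renaming σ X (rename σ X)
rename-renaming σ ∘ = ren-∘
rename-renaming σ (at a) = ren-at
rename-renaming σ (neg a) = ren-neg
rename-renaming σ (par R T) = ren-par (rename-renaming σ R) (rename-renaming σ T)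
rename-renaming σ (copar R T) = ren-copar (rename-renaming σ R) (rename-renaming σ T)
rename-renaming σ (seq R T) = ren-seq (rename-renaming σ R) (rename-renaming σ T)
rename-renaming σ (sdq c R) =
  ren-sdq (λ n p _ → ≤⇒≢suc (maxName-fn σ R p))
          (rename-renaming (update σ c (suc (maxName σ R))) R)

agree-update : ∀ {σ τ c c' R} → (∀ n → n ∈fn R → n ≢ c → σ n ≡ τ n) →
               Agree (update σ c c') (update τ c c') R
agree-update {σ} {τ} {c} {c'} ag n p with n ≟ c
... | yes refl = trans (update-≡ σ c c') (sym (update-≡ τ c c'))
... | no n≢c = trans (update-≢ σ c' n≢c) (trans (ag n p n≢c) (sym (update-≢ τ c' n≢c)))

renaming-agree : ∀ {σ τ X Y} → Renaming σ X Y → Agree σ τ X → Renaming τ X Y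
renaming-agree ren-∘ ag = ren-∘
renaming-agree {τ = τ} (ren-at {a = a}) ag = subst (λ z → Renaming τ (at a) (at z)) (sym (ag a fn-at)) ren-at
renaming-agree {τ = τ} (ren-neg {a = a}) ag = subst (λ z → Renaming τ (neg a) (neg z)) (sym (ag a fn-neg)) ren-neg
renaming-agree (ren-par r t) ag =
  ren-par (renaming-agree r (λ n p → ag n (fn-parˡ p))) (renaming-agree t (λ n p → ag n (fn-parʳ p)))
renaming-agree (ren-copar r t) ag =
  ren-copar (renaming-agree r (λ n p → ag n (fn-coparˡ p))) (renaming-agree t (λ n p → ag n (fn-coparʳ p)))
renaming-agree (ren-seq r t) ag =
  ren-seq (renaming-agree r (λ n p → ag n (fn-seqˡ p))) (renaming-agree t (λ n p → ag n (fn-seqʳ p)))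
renaming-agree (ren-sdq fr r) ag =
  ren-sdq (λ n p ne e → fr n p ne (trans (ag n (fn-sdq ne p)) e))
          (renaming-agree r (agree-update (λ n p ne → ag n (fn-sdq ne p))))

renaming-fn : ∀ {σ X Y n} → Renaming σ X Y → n ∈fn X → σ n ∈fn Y
renaming-fn ren-at fn-at = fn-at
renaming-fn ren-neg fn-neg = fn-neg
renaming-fn (ren-par r t) (fn-parˡ p) = fn-parˡ (renaming-fn r p)
renaming-fn (ren-par r t) (fn-parʳ p) = fn-parʳ (renaming-fn t p)
renaming-fn (ren-copar r t) (fn-coparˡ p) = fn-coparˡ (renaming-fn r p)
renaming-fn (ren-copar r t) (fn-coparʳ p) = fn-coparʳ (renaming-fn t p)
renaming-fn (ren-seq r t) (fn-seqˡ p) = fn-seqˡ (renaming-fn r p)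
renaming-fn (ren-seq r t) (fn-seqʳ p) = fn-seqʳ (renaming-fn t p)
renaming-fn {σ} (ren-sdq {c' = c'} fr r) (fn-sdq ne p) =
  fn-sdq (fr _ p ne) (subst (_∈fn _) (update-≢ σ c' ne) (renaming-fn r p))

renaming-fn⁻ : ∀ {σ X Y m} → Renaming σ X Y → m ∈fn Y → Σ[ n ∈ Name ] n ∈fn X × σ n ≡ m
renaming-fn⁻ ren-at fn-at = _ , fn-at , refl
renaming-fn⁻ ren-neg fn-neg = _ , fn-neg , refl
renaming-fn⁻ (ren-par r t) (fn-parˡ p) = let (n , q , e) = renaming-fn⁻ r p in n , fn-parˡ q , e
renaming-fn⁻ (ren-par r t) (fn-parʳ p) = let (n , q , e) = renaming-fn⁻ t p in n , fn-parʳ q , e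
renaming-fn⁻ (ren-copar r t) (fn-coparˡ p) = let (n , q , e) = renaming-fn⁻ r p in n , fn-coparˡ q , e
renaming-fn⁻ (ren-copar r t) (fn-coparʳ p) = let (n , q , e) = renaming-fn⁻ t p in n , fn-coparʳ q , e
renaming-fn⁻ (ren-seq r t) (fn-seqˡ p) = let (n , q , e) = renaming-fn⁻ r p in n , fn-seqˡ q , e
renaming-fn⁻ (ren-seq r t) (fn-seqʳ p) = let (n , q , e) = renaming-fn⁻ t p in n , fn-seqʳ q , e
renaming-fn⁻ {σ} (ren-sdq {c = c} {c' = c'} fr r) (fn-sdq m≢c' p) with renaming-fn⁻ r p
... | n , q , e with n ≟ c
...   | yes refl = ⊥-elim (m≢c' (trans (sym e) (update-≡ σ c c')))
...   | no n≢c = n , fn-sdq n≢c q , trans (sym (update-≢ σ c' n≢c)) e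

renaming-fn-bound : ∀ {σ X Y m} → Renaming σ X Y → m ∈fn Y → m ≤ maxName σ X
renaming-fn-bound {σ} {X} r p =
  let (n , q , e) = renaming-fn⁻ r p in subst (_≤ maxName σ X) e (maxName-fn σ X q)

renaming-comp : ∀ {σ τ X Y Z} → Renaming σ X Y → Renaming τ Y Z → Renaming (τ ∘ᶠ σ) X Z
renaming-comp ren-∘ ren-∘ = ren-∘
renaming-comp ren-at ren-at = ren-at
renaming-comp ren-neg ren-neg = ren-neg
renaming-comp (ren-par r t) (ren-par r' t') = ren-par (renaming-comp r r') (renaming-comp t t')
renaming-comp (ren-copar r t) (ren-copar r' t') = ren-copar (renaming-comp r r') (renaming-comp t t')
renaming-comp (ren-seq r t) (ren-seq r' t') = ren-seq (renaming-comp r r') (renaming-comp t t')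
renaming-comp {σ} {τ} (ren-sdq {c = c} {c' = c'} {R = R} fr₁ r₁) (ren-sdq {c' = c''} fr₂ r₂) =
  ren-sdq fr (renaming-agree (renaming-comp r₁ r₂) ag)
  where
  fr : ∀ n → n ∈fn R → n ≢ c → τ (σ n) ≢ c''
  fr n p ne = fr₂ (σ n) (subst (_∈fn _) (update-≢ σ c' ne) (renaming-fn r₁ p)) (fr₁ n p ne)
  ag : Agree (update τ c' c'' ∘ᶠ update σ c c') (update (τ ∘ᶠ σ) c c'') R
  ag n p with n ≟ c
  ... | yes refl = trans (cong (update τ c' c'') (update-≡ σ c c'))
                     (trans (update-≡ τ c' c'') (sym (update-≡ (τ ∘ᶠ σ) c c'')))
  ... | no ne = trans (cong (update τ c' c'') (update-≢ σ c' ne))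
                  (trans (update-≢ τ c'' (fr₁ n p ne)) (sym (update-≢ (τ ∘ᶠ σ) c'' ne)))

renaming-id : ∀ X → Renaming idᶠ X X
renaming-id ∘ = ren-∘
renaming-id (at a) = ren-at
renaming-id (neg a) = ren-neg
renaming-id (par R T) = ren-par (renaming-id R) (renaming-id T)
renaming-id (copar R T) = ren-copar (renaming-id R) (renaming-id T)
renaming-id (seq R T) = ren-seq (renaming-id R) (renaming-id T)
renaming-id (sdq c R) = ren-sdq (λ n p ne → ne) (renaming-agree (renaming-id R) ag)
  where
  ag : Agree idᶠ (update idᶠ c c) R
  ag n p with n ≟ c
  ... | yes refl = sym (update-≡ idᶠ c c)
  ... | no ne = sym (update-≢ idᶠ c ne)

renaming-rebind : ∀ {σ c c₁ R Y} → (∀ n → n ∈fn R → n ≢ c → σ n ≢ c₁) → Renaming (update σ c c₁) R Y →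
                  ∀ d → maxName (update σ c c₁) R < d →
                  Σ[ Z ∈ Str ] Renaming (update σ c d) R Z × (sdq c₁ Y ≈ sdq d Z)
renaming-rebind {σ} {c} {c₁} {R} {Y} fr r d lt =
  rename (replace d c₁) Y ,
  renaming-agree (renaming-comp r (rename-renaming (replace d c₁) Y)) ag ,
  sdq-alpha d∉Y
  where
  d∉Y : d ∉fn Y
  d∉Y p = <-irrefl refl (≤-trans (s≤s (renaming-fn-bound r p)) lt)
  ag : Agree (replace d c₁ ∘ᶠ update σ c c₁) (update σ c d) R
  ag n p with n ≟ c
  ... | yes refl = trans (cong (replace d c₁) (update-≡ σ c c₁)) (trans (replace-≡ d c₁) (sym (update-≡ σ c d)))
  ... | no ne = trans (cong (replace d c₁) (update-≢ σ c₁ ne))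
                  (trans (replace-≢ d c₁ (fr n p ne)) (sym (update-≢ σ d ne)))

-- Two renamed quantifiers are ≈ as soon as every common renaming of the bodies
-- is ≈: rebind both to one name that is fresh for both.
sdq-renamings-≈ : ∀ {σ c c₁ c₂ R R' Y Y'} →
  (∀ n → n ∈fn R → n ≢ c → σ n ≢ c₁) → Renaming (update σ c c₁) R Y →
  (∀ n → n ∈fn R' → n ≢ c → σ n ≢ c₂) → Renaming (update σ c c₂) R' Y' →
  (∀ {τ Z Z'} → Renaming τ R Z → Renaming τ R' Z' → Z ≈ Z') → sdq c₁ Y ≈ sdq c₂ Y'
sdq-renamings-≈ {σ} {c} {c₁} {c₂} {R} {R'} fr₁ r₁ fr₂ r₂ bodies =
  let (Z , rZ , eZ) = renaming-rebind fr₁ r₁ d (s≤s (m≤m⊔n _ _))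
      (Z' , rZ' , eZ') = renaming-rebind fr₂ r₂ d (s≤s (m≤n⊔m _ _))
  in ≈-trans eZ (≈-trans (sdq-cong (bodies rZ rZ')) (≈-sym eZ'))
  where
  d = suc (maxName (update σ c c₁) R ⊔ maxName (update σ c c₂) R')

-- Renamings are unique up to ≈ (they differ only in the choice of bound names).
renaming-unique : ∀ X {σ Y Y'} → Renaming σ X Y → Renaming σ X Y' → Y ≈ Y'
renaming-unique ∘ ren-∘ ren-∘ = ≈-refl
renaming-unique (at a) ren-at ren-at = ≈-refl
renaming-unique (neg a) ren-neg ren-neg = ≈-refl
renaming-unique (par R T) (ren-par r t) (ren-par r' t') = par-cong (renaming-unique R r r') (renaming-unique T t t')
renaming-unique (copar R T) (ren-copar r t) (ren-copar r' t') = copar-cong (renaming-unique R r r') (renaming-unique T t t')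
renaming-unique (seq R T) (ren-seq r t) (ren-seq r' t') = seq-cong (renaming-unique R r r') (renaming-unique T t t')
renaming-unique (sdq c R) (ren-sdq fr₁ r₁) (ren-sdq fr₂ r₂) = sdq-renamings-≈ fr₁ r₁ fr₂ r₂ (renaming-unique R)

renaming-sdq-vac : ∀ {a R σ Y Y'} → a ∉fn R → Renaming σ (sdq a R) Y → Renaming σ R Y' → Y ≈ Y'
renaming-sdq-vac {a} {R} {σ} a∉R (ren-sdq {c' = c'} {R' = Y} fr r) r' =
  ≈-trans (sdq-vac c'∉Y) (renaming-unique _ (renaming-agree r ag) r')
  where
  ≢a : ∀ {n} → n ∈fn R → n ≢ a
  ≢a p e = a∉R (subst (_∈fn R) e p)
  ag : Agree (update σ a c') σ R
  ag n p = update-≢ σ c' (≢a p)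
  c'∉Y : c' ∉fn Y
  c'∉Y p with renaming-fn⁻ r p
  ... | n , q , e = fr n q (≢a q) (trans (sym (update-≢ σ c' (≢a q))) e)

renaming-sdq-alpha : ∀ {a b R σ Y Y'} → b ∉fn R →
                     Renaming σ (sdq a R) Y → Renaming σ (sdq b (R [ b / a ])) Y' → Y ≈ Y'
renaming-sdq-alpha {a} {b} {R} {σ} b∉R r (ren-sdq {c' = c₂} fr₂ r₂) =
  renaming-unique _ r (ren-sdq fr (renaming-agree (renaming-comp (rename-renaming (replace b a) R) r₂) ag))
  where
  ≢b : ∀ {n} → n ∈fn R → n ≢ b
  ≢b p e = b∉R (subst (_∈fn R) e p)
  ag : Agree (update σ b c₂ ∘ᶠ replace b a) (update σ a c₂) R
  ag n p with n ≟ a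
  ... | yes refl = trans (cong (update σ b c₂) (replace-≡ b a)) (trans (update-≡ σ b c₂) (sym (update-≡ σ a c₂)))
  ... | no ne = trans (cong (update σ b c₂) (replace-≢ b a ne))
                  (trans (update-≢ σ c₂ (≢b p)) (sym (update-≢ σ c₂ ne)))
  fr : ∀ n → n ∈fn R → n ≢ a → σ n ≢ c₂
  fr n p ne = fr₂ n (subst (_∈fn _) (replace-≢ b a ne) (renaming-fn (rename-renaming (replace b a) R) p)) (≢b p)

-- For swapped quantifiers, rename both binders to the same two fresh names.
renaming-sdq-swap : ∀ {a b R σ Y Y'} →
                    Renaming σ (sdq a (sdq b R)) Y → Renaming σ (sdq b (sdq a R)) Y' → Y ≈ Y'
renaming-sdq-swap {a} {b} {R} {σ} r r' with a ≟ b
... | yes refl = renaming-unique _ r r'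
... | no a≢b = ≈-trans (renaming-unique _ r ab) (≈-trans sdq-swap (renaming-unique _ ba r'))
  where
  K = maxName σ (sdq a (sdq b R))
  e₁ = suc K
  e₂ = suc (suc K)
  e₁≢e₂ : e₁ ≢ e₂
  e₁≢e₂ = ≤⇒≢suc ≤-refl
  bound : ∀ {n} → n ∈fn R → n ≢ a → n ≢ b → σ n ≤ K
  bound p na nb = maxName-fn σ (sdq a (sdq b R)) (fn-sdq na (fn-sdq nb p))
  ab : Renaming σ (sdq a (sdq b R)) (sdq e₁ (sdq e₂ (rename (update (update σ a e₁) b e₂) R)))
  ab = ren-sdq outer (ren-sdq inner (rename-renaming _ R))
    where
    outer : ∀ n → n ∈fn sdq b R → n ≢ a → σ n ≢ e₁
    outer n (fn-sdq nb p) na = ≤⇒≢suc (bound p na nb)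
    inner : ∀ n → n ∈fn R → n ≢ b → update σ a e₁ n ≢ e₂
    inner n p nb with n ≟ a
    ... | yes refl = subst (_≢ e₂) (sym (update-≡ σ n e₁)) e₁≢e₂
    ... | no na = subst (_≢ e₂) (sym (update-≢ σ e₁ na)) (≤⇒≢suc² (bound p na nb))
  ba : Renaming σ (sdq b (sdq a R)) (sdq e₂ (sdq e₁ (rename (update (update σ a e₁) b e₂) R)))
  ba = ren-sdq outer (ren-sdq inner (renaming-agree (rename-renaming _ R) ag))
    where
    outer : ∀ n → n ∈fn sdq a R → n ≢ b → σ n ≢ e₂
    outer n (fn-sdq na p) nb = ≤⇒≢suc² (bound p na nb)
    inner : ∀ n → n ∈fn R → n ≢ a → update σ b e₂ n ≢ e₁
    inner n p na with n ≟ b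
    ... | yes refl = subst (_≢ e₁) (sym (update-≡ σ n e₂)) (λ e → e₁≢e₂ (sym e))
    ... | no nb = subst (_≢ e₁) (sym (update-≢ σ e₂ nb)) (≤⇒≢suc (bound p na nb))
    ag : Agree (update (update σ a e₁) b e₂) (update (update σ b e₂) a e₁) R
    ag n p with n ≟ a | n ≟ b
    ... | yes refl | yes refl = ⊥-elim (a≢b refl)
    ... | yes refl | no nb = trans (update-≢ (update σ n e₁) e₂ nb)
                               (trans (update-≡ σ n e₁) (sym (update-≡ (update σ b e₂) n e₁)))
    ... | no na | yes refl = trans (update-≡ (update σ a e₁) n e₂)
                               (sym (trans (update-≢ (update σ n e₂) e₁ na) (update-≡ σ n e₂)))
    ... | no na | no nb = trans (update-≢ (update σ a e₁) e₂ nb)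
                            (trans (update-≢ σ e₁ na)
                              (sym (trans (update-≢ (update σ b e₂) e₁ na) (update-≢ σ e₂ nb))))

renaming-resp-≈ : ∀ {P Q} → P ≈ Q → ∀ {σ P' Q'} → Renaming σ P P' → Renaming σ Q Q' → P' ≈ Q'
renaming-resp-≈ ≈-refl r r' = renaming-unique _ r r'
renaming-resp-≈ (≈-sym e) r r' = ≈-sym (renaming-resp-≈ e r' r)
renaming-resp-≈ (≈-trans {T = T} e e') {σ} r r' =
  ≈-trans (renaming-resp-≈ e r (rename-renaming σ T)) (renaming-resp-≈ e' (rename-renaming σ T) r')
renaming-resp-≈ (par-cong e e') (ren-par r t) (ren-par r' t') = par-cong (renaming-resp-≈ e r r') (renaming-resp-≈ e' t t')
renaming-resp-≈ (copar-cong e e') (ren-copar r t) (ren-copar r' t') = copar-cong (renaming-resp-≈ e r r') (renaming-resp-≈ e' t t')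
renaming-resp-≈ (seq-cong e e') (ren-seq r t) (ren-seq r' t') = seq-cong (renaming-resp-≈ e r r') (renaming-resp-≈ e' t t')
renaming-resp-≈ (sdq-cong e) (ren-sdq fr r) (ren-sdq fr' r') = sdq-renamings-≈ fr r fr' r' (renaming-resp-≈ e)
renaming-resp-≈ par-assoc (ren-par (ren-par r t) u) (ren-par r' (ren-par t' u')) =
  ≈-trans par-assoc (par-cong (renaming-unique _ r r') (par-cong (renaming-unique _ t t') (renaming-unique _ u u')))
renaming-resp-≈ copar-assoc (ren-copar (ren-copar r t) u) (ren-copar r' (ren-copar t' u')) =
  ≈-trans copar-assoc (copar-cong (renaming-unique _ r r') (copar-cong (renaming-unique _ t t') (renaming-unique _ u u')))
renaming-resp-≈ seq-assoc (ren-seq (ren-seq r t) u) (ren-seq r' (ren-seq t' u')) =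
  ≈-trans seq-assoc (seq-cong (renaming-unique _ r r') (seq-cong (renaming-unique _ t t') (renaming-unique _ u u')))
renaming-resp-≈ par-comm (ren-par r t) (ren-par t' r') =
  ≈-trans par-comm (par-cong (renaming-unique _ t t') (renaming-unique _ r r'))
renaming-resp-≈ copar-comm (ren-copar r t) (ren-copar t' r') =
  ≈-trans copar-comm (copar-cong (renaming-unique _ t t') (renaming-unique _ r r'))
renaming-resp-≈ par-unitˡ (ren-par ren-∘ r) r' = ≈-trans par-unitˡ (renaming-unique _ r r')
renaming-resp-≈ par-unitʳ (ren-par r ren-∘) r' = ≈-trans par-unitʳ (renaming-unique _ r r')
renaming-resp-≈ copar-unitˡ (ren-copar ren-∘ r) r' = ≈-trans copar-unitˡ (renaming-unique _ r r')
renaming-resp-≈ copar-unitʳ (ren-copar r ren-∘) r' = ≈-trans copar-unitʳ (renaming-unique _ r r')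
renaming-resp-≈ seq-unitˡ (ren-seq ren-∘ r) r' = ≈-trans seq-unitˡ (renaming-unique _ r r')
renaming-resp-≈ seq-unitʳ (ren-seq r ren-∘) r' = ≈-trans seq-unitʳ (renaming-unique _ r r')
renaming-resp-≈ (sdq-vac a∉R) r r' = renaming-sdq-vac a∉R r r'
renaming-resp-≈ (sdq-alpha b∉R) r r' = renaming-sdq-alpha b∉R r r'
renaming-resp-≈ sdq-swap r r' = renaming-sdq-swap r r'

rename-cong : ∀ σ {P Q} → P ≈ Q → rename σ P ≈ rename σ Q
rename-cong σ {P} {Q} e = renaming-resp-≈ e (rename-renaming σ P) (rename-renaming σ Q)

rename-agree : ∀ {σ τ} X → Agree σ τ X → rename σ X ≈ rename τ X
rename-agree {σ} {τ} X ag = renaming-unique X (renaming-agree (rename-renaming σ X) ag) (rename-renaming τ X)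

rename-comp : ∀ σ τ X → rename τ (rename σ X) ≈ rename (τ ∘ᶠ σ) X
rename-comp σ τ X =
  renaming-unique X (renaming-comp (rename-renaming σ X) (rename-renaming τ (rename σ X))) (rename-renaming (τ ∘ᶠ σ) X)

rename-id : ∀ {σ} X → Agree σ idᶠ X → rename σ X ≈ X
rename-id {σ} X ag = renaming-unique X (renaming-agree (rename-renaming σ X) ag) (renaming-id X)

rename-sdq-fixed : ∀ σ c Z → σ c ≡ c → (∀ n → n ∈fn Z → n ≢ c → σ n ≢ c) →
                   rename σ (sdq c Z) ≈ sdq c (rename σ Z)
rename-sdq-fixed σ c Z σc≡c fr =
  renaming-unique _ (rename-renaming σ (sdq c Z)) (ren-sdq fr (renaming-agree (rename-renaming σ Z) ag))
  where
  ag : Agree σ (update σ c c) Z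
  ag n p with n ≟ c
  ... | yes refl = trans σc≡c (sym (update-≡ σ n n))
  ... | no ne = sym (update-≢ σ c ne)

_⊚_ : Ctx → Ctx → Ctx
hole ⊚ S' = S'
parˡ S T ⊚ S' = parˡ (S ⊚ S') T
parʳ T S ⊚ S' = parʳ T (S ⊚ S')
coparˡ S T ⊚ S' = coparˡ (S ⊚ S') T
coparʳ T S ⊚ S' = coparʳ T (S ⊚ S')
seqˡ S T ⊚ S' = seqˡ (S ⊚ S') T
seqʳ T S ⊚ S' = seqʳ T (S ⊚ S')
sdqᶜ a S ⊚ S' = sdqᶜ a (S ⊚ S')

plug-⊚ : ∀ S S' P → plug S (plug S' P) ≡ plug (S ⊚ S') P
plug-⊚ hole S' P = refl
plug-⊚ (parˡ S T) S' P = cong (λ z → par z T) (plug-⊚ S S' P)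
plug-⊚ (parʳ T S) S' P = cong (par T) (plug-⊚ S S' P)
plug-⊚ (coparˡ S T) S' P = cong (λ z → copar z T) (plug-⊚ S S' P)
plug-⊚ (coparʳ T S) S' P = cong (copar T) (plug-⊚ S S' P)
plug-⊚ (seqˡ S T) S' P = cong (λ z → seq z T) (plug-⊚ S S' P)
plug-⊚ (seqʳ T S) S' P = cong (seq T) (plug-⊚ S S' P)
plug-⊚ (sdqᶜ a S) S' P = cong (sdq a) (plug-⊚ S S' P)

plug-cong : ∀ S {R R'} → R ≈ R' → plug S R ≈ plug S R'
plug-cong hole e = e
plug-cong (parˡ S T) e = par-cong (plug-cong S e) ≈-refl
plug-cong (parʳ T S) e = par-cong ≈-refl (plug-cong S e)
plug-cong (coparˡ S T) e = copar-cong (plug-cong S e) ≈-refl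
plug-cong (coparʳ T S) e = copar-cong ≈-refl (plug-cong S e)
plug-cong (seqˡ S T) e = seq-cong (plug-cong S e) ≈-refl
plug-cong (seqʳ T S) e = seq-cong ≈-refl (plug-cong S e)
plug-cong (sdqᶜ a S) e = sdq-cong (plug-cong S e)

≡⇒≈ : ∀ {A B} → A ≡ B → A ≈ B
≡⇒≈ refl = ≈-refl

⊢-plug : ∀ {X} → ⊢BVQ X → ∀ S → ⊢BVQ (plug S ∘) → ⊢BVQ (plug S X)
⊢-plug ax S d₀ = d₀
⊢-plug (≈-step d e) S d₀ = ≈-step (⊢-plug d S d₀) (plug-cong S e)
⊢-plug (rule {P} {Q} S' d r) S d₀ =
  subst ⊢BVQ (sym (plug-⊚ S S' Q)) (rule (S ⊚ S') (subst ⊢BVQ (plug-⊚ S S' P) (⊢-plug d S d₀)) r)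

⊢-unit : ∀ S → plug S ∘ ≈ ∘ → ⊢BVQ (plug S ∘)
⊢-unit S e = ≈-step ax (≈-sym e)

data Step : Str → Str → Set where
  step : ∀ S {P Q} → Rule P Q → Step (plug S P) (plug S Q)

infix 4 _⇝_
_⇝_ : Str → Str → Set
A ⇝ B = (A ≈ B) ⊎ (Σ[ A' ∈ Str ] Σ[ B' ∈ Str ] (A ≈ A') × Step A' B' × (B' ≈ B))

⊢-⇝ : ∀ {A B} → ⊢BVQ A → A ⇝ B → ⊢BVQ B
⊢-⇝ d (inj₁ e) = ≈-step d e
⊢-⇝ d (inj₂ (A' , B' , e , step S r , e')) = ≈-step (rule S (≈-step d e) r) e'

step-⇝ : ∀ {A B} → Step A B → A ⇝ B
step-⇝ st = inj₂ (_ , _ , ≈-refl , st , ≈-refl)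

rule-⇝ : ∀ {P Q} → Rule P Q → P ⇝ Q
rule-⇝ r = step-⇝ (step hole r)

⇝-resp-≈ : ∀ {A A' B' B} → A ≈ A' → A' ⇝ B' → B' ≈ B → A ⇝ B
⇝-resp-≈ e (inj₁ x) e' = inj₁ (≈-trans e (≈-trans x e'))
⇝-resp-≈ e (inj₂ (A'' , B'' , x , st , x')) e' = inj₂ (A'' , B'' , ≈-trans e x , st , ≈-trans x' e')

⇝-plug : ∀ {A B} → A ⇝ B → ∀ S → plug S A ⇝ plug S B
⇝-plug (inj₁ e) S = inj₁ (plug-cong S e)
⇝-plug (inj₂ (_ , _ , e , step S' {P} {Q} r , e')) S =
  inj₂ (_ , _ , ≈-trans (plug-cong S e) (≡⇒≈ (plug-⊚ S S' P)) , step (S ⊚ S') r ,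
        ≈-trans (≡⇒≈ (sym (plug-⊚ S S' Q))) (plug-cong S e'))

rule-renaming : ∀ σ {P Q} → Rule P Q →
                Σ[ P' ∈ Str ] Σ[ Q' ∈ Str ] Rule P' Q' × Renaming σ P P' × Renaming σ Q Q'
rule-renaming σ (ai↓ a) = _ , _ , ai↓ (σ a) , ren-∘ , ren-par ren-at ren-neg
rule-renaming σ (s R T U) =
  _ , _ , s _ _ _ ,
  ren-copar (ren-par (rename-renaming σ R) (rename-renaming σ U)) (rename-renaming σ T) ,
  ren-par (ren-copar (rename-renaming σ R) (rename-renaming σ T)) (rename-renaming σ U)
rule-renaming σ (q↓ R T U V) =
  _ , _ , q↓ _ _ _ _ ,
  ren-seq (ren-par (rename-renaming σ R) (rename-renaming σ U)) (ren-par (rename-renaming σ T) (rename-renaming σ V)) ,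
  ren-par (ren-seq (rename-renaming σ R) (rename-renaming σ T)) (ren-seq (rename-renaming σ U) (rename-renaming σ V))
rule-renaming σ (u↓ a R U) =
  _ , _ , u↓ e _ _ ,
  ren-sdq (λ n p _ → ≤⇒≢suc (maxName-fn σ (par R U) p)) (ren-par (rename-renaming σ' R) (rename-renaming σ' U)) ,
  ren-par (ren-sdq frR (rename-renaming σ' R)) (ren-sdq frU (rename-renaming σ' U))
  where
  e = suc (maxName σ R ⊔ maxName σ U)
  σ' = update σ a e
  frR : ∀ n → n ∈fn R → n ≢ a → σ n ≢ e
  frR n p _ = ≤⇒≢suc (≤-trans (maxName-fn σ R p) (m≤m⊔n _ _))
  frU : ∀ n → n ∈fn U → n ≢ a → σ n ≢ e
  frU n p _ = ≤⇒≢suc (≤-trans (maxName-fn σ U p) (m≤n⊔m _ _))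

RenamedStep : Ctx → (Name → Name) → Str → Str → Set
RenamedStep S σ P Q = Σ[ S' ∈ Ctx ] Σ[ P' ∈ Str ] Σ[ Q' ∈ Str ]
  Rule P' Q' × Renaming σ (plug S P) (plug S' P') × Renaming σ (plug S Q) (plug S' Q')

ctx-rule-renaming : ∀ S σ {P Q} → Rule P Q → RenamedStep S σ P Q
ctx-rule-renaming hole σ r = let (P' , Q' , r' , rP , rQ) = rule-renaming σ r in hole , P' , Q' , r' , rP , rQ
ctx-rule-renaming (parˡ S T) σ r = let (S' , P' , Q' , r' , rP , rQ) = ctx-rule-renaming S σ r in
  parˡ S' (rename σ T) , P' , Q' , r' , ren-par rP (rename-renaming σ T) , ren-par rQ (rename-renaming σ T)
ctx-rule-renaming (parʳ T S) σ r = let (S' , P' , Q' , r' , rP , rQ) = ctx-rule-renaming S σ r in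
  parʳ (rename σ T) S' , P' , Q' , r' , ren-par (rename-renaming σ T) rP , ren-par (rename-renaming σ T) rQ
ctx-rule-renaming (coparˡ S T) σ r = let (S' , P' , Q' , r' , rP , rQ) = ctx-rule-renaming S σ r in
  coparˡ S' (rename σ T) , P' , Q' , r' , ren-copar rP (rename-renaming σ T) , ren-copar rQ (rename-renaming σ T)
ctx-rule-renaming (coparʳ T S) σ r = let (S' , P' , Q' , r' , rP , rQ) = ctx-rule-renaming S σ r in
  coparʳ (rename σ T) S' , P' , Q' , r' , ren-copar (rename-renaming σ T) rP , ren-copar (rename-renaming σ T) rQ
ctx-rule-renaming (seqˡ S T) σ r = let (S' , P' , Q' , r' , rP , rQ) = ctx-rule-renaming S σ r in
  seqˡ S' (rename σ T) , P' , Q' , r' , ren-seq rP (rename-renaming σ T) , ren-seq rQ (rename-renaming σ T)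
ctx-rule-renaming (seqʳ T S) σ r = let (S' , P' , Q' , r' , rP , rQ) = ctx-rule-renaming S σ r in
  seqʳ (rename σ T) S' , P' , Q' , r' , ren-seq (rename-renaming σ T) rP , ren-seq (rename-renaming σ T) rQ
ctx-rule-renaming (sdqᶜ c S) σ {P} {Q} r =
  let (S' , P' , Q' , r' , rP , rQ) = ctx-rule-renaming S (update σ c e) r in
  sdqᶜ e S' , P' , Q' , r' ,
  ren-sdq (λ n p _ → ≤⇒≢suc (≤-trans (maxName-fn σ _ p) (m≤m⊔n _ _))) rP ,
  ren-sdq (λ n p _ → ≤⇒≢suc (≤-trans (maxName-fn σ _ p) (m≤n⊔m _ _))) rQ
  where
  e = suc (maxName σ (plug S P) ⊔ maxName σ (plug S Q))

⇝-rename : ∀ {A B} → A ⇝ B → ∀ σ → rename σ A ⇝ rename σ B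
⇝-rename (inj₁ e) σ = inj₁ (rename-cong σ e)
⇝-rename (inj₂ (_ , _ , e , step S r , e')) σ =
  let (S' , P' , Q' , r' , rP , rQ) = ctx-rule-renaming S σ r
  in ⇝-resp-≈ (rename-cong σ e)
       (inj₂ (_ , _ , renaming-unique _ (rename-renaming σ _) rP , step S' r' , renaming-unique _ rQ (rename-renaming σ _)))
       (rename-cong σ e')

⊢-rename : ∀ {X} → ⊢BVQ X → ∀ σ → ⊢BVQ (rename σ X)
⊢-rename ax σ = ax
⊢-rename (≈-step d e) σ = ≈-step (⊢-rename d σ) (rename-cong σ e)
⊢-rename (rule S d r) σ = ⊢-⇝ (⊢-rename d σ) (⇝-rename (step-⇝ (step S r)) σ)

-- The summary of an annotated structure records whether it contains a kept
-- atom, an erased atom, and an atom under an instantiated quantifier ("marked").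
record Summary : Set where
  constructor summary
  field kept erased marked : Bool
open Summary

infixl 6 _⊕_
_⊕_ : Summary → Summary → Summary
w ⊕ u = summary (kept w ∨ kept u) (erased w ∨ erased u) (marked w ∨ marked u)

∅ : Summary
∅ = summary false false false

-- Summary of Sdq a.X when X has summary w; `inst` says whether it is instantiated.
underSdq : Bool → Summary → Summary
underSdq inst w = summary (kept w) (erased w) ((inst ∧ (kept w ∨ erased w)) ∨ marked w)

summary-≡ : ∀ {a b c a' b' c'} → a ≡ a' → b ≡ b' → c ≡ c' → summary a b c ≡ summary a' b' c'
summary-≡ refl refl refl = refl

⊕-comm : ∀ w u → w ⊕ u ≡ u ⊕ w
⊕-comm w u = summary-≡ (∨-comm (kept w) _) (∨-comm (erased w) _) (∨-comm (marked w) _)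

⊕-assoc : ∀ w u v → w ⊕ u ⊕ v ≡ w ⊕ (u ⊕ v)
⊕-assoc w u v = summary-≡ (∨-assoc (kept w) _ _) (∨-assoc (erased w) _ _) (∨-assoc (marked w) _ _)

⊕-identityʳ : ∀ w → w ⊕ ∅ ≡ w
⊕-identityʳ w = summary-≡ (∨-identityʳ (kept w)) (∨-identityʳ (erased w)) (∨-identityʳ (marked w))

infix 4 _≼_
_≼_ : Summary → Summary → Set
w ≼ u = (kept u ≡ false → kept w ≡ false) × (erased u ≡ false → erased w ≡ false)
      × (marked u ≡ false → marked w ≡ false)

∨-false : ∀ {x y} → x ≡ false → y ≡ false → x ∨ y ≡ false
∨-false refl refl = refl

∨-falseˡ : ∀ {x y} → x ∨ y ≡ false → x ≡ false
∨-falseˡ {x} {y} = ∨-conicalˡ x y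

∨-falseʳ : ∀ {x y} → x ∨ y ≡ false → y ≡ false
∨-falseʳ {x} {y} = ∨-conicalʳ x y

≼-reflexive : ∀ {w u} → w ≡ u → w ≼ u
≼-reflexive refl = (λ e → e) , (λ e → e) , (λ e → e)

≼-refl : ∀ {w} → w ≼ w
≼-refl = ≼-reflexive refl

≼-trans : ∀ {w u v} → w ≼ u → u ≼ v → w ≼ v
≼-trans (k , e , m) (k' , e' , m') = (λ x → k (k' x)) , (λ x → e (e' x)) , (λ x → m (m' x))

∅≼ : ∀ {w} → ∅ ≼ w
∅≼ = (λ _ → refl) , (λ _ → refl) , (λ _ → refl)

≼-⊕ : ∀ {w w' u u'} → w ≼ w' → u ≼ u' → w ⊕ u ≼ w' ⊕ u'
≼-⊕ (k , e , m) (k' , e' , m') =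
  (λ x → ∨-false (k (∨-falseˡ x)) (k' (∨-falseʳ x))) ,
  (λ x → ∨-false (e (∨-falseˡ x)) (e' (∨-falseʳ x))) ,
  (λ x → ∨-false (m (∨-falseˡ x)) (m' (∨-falseʳ x)))

≼-⊕ˡ : ∀ {w u} → w ≼ w ⊕ u
≼-⊕ˡ = ∨-falseˡ , ∨-falseˡ , ∨-falseˡ

≼-⊕ʳ : ∀ {w u} → u ≼ w ⊕ u
≼-⊕ʳ {w} {u} = ∨-falseʳ {kept w} , ∨-falseʳ {erased w} , ∨-falseʳ {marked w}

-- The two rearrangements of summaries performed by the switch and seq rules.
⊕-swap₂₃ : ∀ w u v → w ⊕ v ⊕ u ≡ w ⊕ u ⊕ v
⊕-swap₂₃ w u v = begin
  w ⊕ v ⊕ u   ≡⟨ ⊕-assoc w v u ⟩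
  w ⊕ (v ⊕ u) ≡⟨ cong (w ⊕_) (⊕-comm v u) ⟩
  w ⊕ (u ⊕ v) ≡⟨ sym (⊕-assoc w u v) ⟩
  w ⊕ u ⊕ v   ∎

⊕-middle : ∀ a b c d → a ⊕ c ⊕ (b ⊕ d) ≡ a ⊕ b ⊕ (c ⊕ d)
⊕-middle a b c d = begin
  a ⊕ c ⊕ (b ⊕ d) ≡⟨ sym (⊕-assoc (a ⊕ c) b d) ⟩
  a ⊕ c ⊕ b ⊕ d   ≡⟨ cong (_⊕ d) (⊕-swap₂₃ a b c) ⟩
  a ⊕ b ⊕ c ⊕ d   ≡⟨ ⊕-assoc (a ⊕ b) c d ⟩
  a ⊕ b ⊕ (c ⊕ d) ∎

underSdq-mono : ∀ inst {w u} → w ≼ u → underSdq inst w ≼ underSdq inst u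
underSdq-mono false w≼u = w≼u
underSdq-mono true {w} {u} (k , e , m) = k , e , λ x →
  ∨-false {kept w ∨ erased w} (∨-false {kept w} (k (∨-falseˡ (∨-falseˡ x))) (e (∨-falseʳ {kept u} (∨-falseˡ x))))
          (m (∨-falseʳ {kept u ∨ erased u} x))

underSdq-≽ : ∀ inst {w} → w ≼ underSdq inst w
underSdq-≽ inst {w} = (λ x → x) , (λ x → x) , ∨-falseʳ {inst ∧ (kept w ∨ erased w)}

∨-shuffle-false : ∀ a b c a' b' c' → ((a ∨ b) ∨ c) ∨ ((a' ∨ b') ∨ c') ≡ false →
                  ((a ∨ a') ∨ (b ∨ b')) ∨ (c ∨ c') ≡ false
∨-shuffle-false false false false false false false refl = refl
∨-shuffle-false true _ _ _ _ _ ()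
∨-shuffle-false false true _ _ _ _ ()
∨-shuffle-false false false true _ _ _ ()
∨-shuffle-false false false false true _ _ ()
∨-shuffle-false false false false false true _ ()
∨-shuffle-false false false false false false true ()

underSdq-⊕ : ∀ w u → underSdq true (w ⊕ u) ≼ underSdq true w ⊕ underSdq true u
underSdq-⊕ w u =
  (λ x → x) , (λ x → x) ,
  ∨-shuffle-false (kept w) (erased w) (marked w) (kept u) (erased u) (marked u)

underSdq-swap : ∀ i₁ i₂ w → underSdq i₁ (underSdq i₂ w) ≼ underSdq i₂ (underSdq i₁ w)
underSdq-swap false false w = ≼-refl
underSdq-swap false true w = ≼-refl
underSdq-swap true false w = ≼-refl
underSdq-swap true true w = ≼-refl

Empty : Summary → Set
Empty w = kept w ≡ false × erased w ≡ false × marked w ≡ false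

underSdq-empty : ∀ inst {u} → Empty u → underSdq inst u ≼ u
underSdq-empty false _ = ≼-refl
underSdq-empty true {u} (k , e , _) = (λ x → x) , (λ x → x) , ∨-false (∨-false {kept u} k e)

Empty-≼ : ∀ {w u} → u ≼ w → Empty w → Empty u
Empty-≼ (k , e , m) (k' , e' , m') = k k' , e e' , m m'

Empty-⊕ : ∀ {w u} → Empty w → Empty u → Empty (w ⊕ u)
Empty-⊕ (k , e , m) (k' , e' , m') = ∨-false k k' , ∨-false e e' , ∨-false m m'

Monochrome : Summary → Summary → Set
Monochrome w u = (kept w ≡ false × kept u ≡ false) ⊎ (erased w ≡ false × erased u ≡ false)

-- The two sides of a par may meet: one is atom-free, or neither is marked and
-- together they are monochrome.  This is what keeps ai↓ and u↓ reflectable.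
Compatible : Summary → Summary → Set
Compatible w u = Empty w ⊎ Empty u ⊎ (Monochrome w u × marked w ≡ false × marked u ≡ false)

compatible-≼ : ∀ {w w' u u'} → w' ≼ w → u' ≼ u → Compatible w u → Compatible w' u'
compatible-≼ w'≼w u'≼u (inj₁ e) = inj₁ (Empty-≼ w'≼w e)
compatible-≼ w'≼w u'≼u (inj₂ (inj₁ e)) = inj₂ (inj₁ (Empty-≼ u'≼u e))
compatible-≼ (k , _ , m) (k' , _ , m') (inj₂ (inj₂ (inj₁ (x , y) , mw , mu))) = inj₂ (inj₂ (inj₁ (k x , k' y) , m mw , m' mu))
compatible-≼ (_ , e , m) (_ , e' , m') (inj₂ (inj₂ (inj₂ (x , y) , mw , mu))) = inj₂ (inj₂ (inj₂ (e x , e' y) , m mw , m' mu))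

compatible-comm : ∀ {w u} → Compatible w u → Compatible u w
compatible-comm (inj₁ e) = inj₂ (inj₁ e)
compatible-comm (inj₂ (inj₁ e)) = inj₁ e
compatible-comm (inj₂ (inj₂ (inj₁ (x , y) , mw , mu))) = inj₂ (inj₂ (inj₁ (y , x) , mu , mw))
compatible-comm (inj₂ (inj₂ (inj₂ (x , y) , mw , mu))) = inj₂ (inj₂ (inj₂ (y , x) , mu , mw))

compatible-assoc : ∀ {w u v} → Compatible w u → Compatible (w ⊕ u) v → Compatible u v × Compatible w (u ⊕ v)
compatible-assoc _ (inj₁ (k , e , m)) = inj₁ (∨-falseʳ k , ∨-falseʳ e , ∨-falseʳ m) , inj₁ (∨-falseˡ k , ∨-falseˡ e , ∨-falseˡ m)
compatible-assoc (inj₁ ew) (inj₂ (inj₁ ev)) = inj₂ (inj₁ ev) , inj₁ ew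
compatible-assoc (inj₂ (inj₁ eu)) (inj₂ (inj₁ ev)) = inj₂ (inj₁ ev) , inj₂ (inj₁ (Empty-⊕ eu ev))
compatible-assoc (inj₂ (inj₂ (inj₁ (x , y) , mw , mu))) (inj₂ (inj₁ (k , e , m))) =
  inj₂ (inj₁ (k , e , m)) , inj₂ (inj₂ (inj₁ (x , ∨-false y k) , mw , ∨-false mu m))
compatible-assoc (inj₂ (inj₂ (inj₂ (x , y) , mw , mu))) (inj₂ (inj₁ (k , e , m))) =
  inj₂ (inj₁ (k , e , m)) , inj₂ (inj₂ (inj₂ (x , ∨-false y e) , mw , ∨-false mu m))
compatible-assoc _ (inj₂ (inj₂ (inj₁ (x , y) , mwu , mv))) =
  inj₂ (inj₂ (inj₁ (∨-falseʳ x , y) , ∨-falseʳ mwu , mv)) ,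
  inj₂ (inj₂ (inj₁ (∨-falseˡ x , ∨-false (∨-falseʳ x) y) , ∨-falseˡ mwu , ∨-false (∨-falseʳ mwu) mv))
compatible-assoc _ (inj₂ (inj₂ (inj₂ (x , y) , mwu , mv))) =
  inj₂ (inj₂ (inj₂ (∨-falseʳ x , y) , ∨-falseʳ mwu , mv)) ,
  inj₂ (inj₂ (inj₂ (∨-falseˡ x , ∨-false (∨-falseʳ x) y) , ∨-falseˡ mwu , ∨-false (∨-falseʳ mwu) mv))

compatible-assoc' : ∀ {w u v} → Compatible u v → Compatible w (u ⊕ v) → Compatible w u × Compatible (w ⊕ u) v
compatible-assoc' {w} {u} {v} cuv cw =
  let (cuw , cvuw) = compatible-assoc (compatible-comm cuv) (compatible-≼ (≼-reflexive (⊕-comm v u)) ≼-refl (compatible-comm cw))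
  in compatible-comm cuw , compatible-≼ (≼-reflexive (⊕-comm w u)) ≼-refl (compatible-comm cvuw)

-- An annotation colours every atom (true = kept, false = erased) and marks
-- every quantifier (true = instantiated).
Annot : Str → Set
Annot ∘ = ⊤
Annot (at a) = Bool
Annot (neg a) = Bool
Annot (par R T) = Annot R × Annot T
Annot (copar R T) = Annot R × Annot T
Annot (seq R T) = Annot R × Annot T
Annot (sdq a R) = Bool × Annot R

colour : Bool → Summary
colour true = summary true false false
colour false = summary false true false

summaryOf : (X : Str) → Annot X → Summary
summaryOf ∘ _ = ∅
summaryOf (at a) k = colour k
summaryOf (neg a) k = colour k
summaryOf (par R T) (r , t) = summaryOf R r ⊕ summaryOf T t
summaryOf (copar R T) (r , t) = summaryOf R r ⊕ summaryOf T t
summaryOf (seq R T) (r , t) = summaryOf R r ⊕ summaryOf T t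
summaryOf (sdq a R) (i , r) = underSdq i (summaryOf R r)

Consistent : (X : Str) → Annot X → Set
Consistent ∘ _ = ⊤
Consistent (at a) _ = ⊤
Consistent (neg a) _ = ⊤
Consistent (par R T) (r , t) = Consistent R r × Consistent T t × Compatible (summaryOf R r) (summaryOf T t)
Consistent (copar R T) (r , t) = Consistent R r × Consistent T t
Consistent (seq R T) (r , t) = Consistent R r × Consistent T t
Consistent (sdq a R) (_ , r) = Consistent R r

project : Name → (X : Str) → Annot X → Str
project f ∘ _ = ∘
project f (at a) true = at a
project f (at a) false = ∘
project f (neg a) true = neg a
project f (neg a) false = ∘
project f (par R T) (r , t) = par (project f R r) (project f T t)
project f (copar R T) (r , t) = copar (project f R r) (project f T t)
project f (seq R T) (r , t) = seq (project f R r) (project f T t)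
project f (sdq a R) (true , r) = rename (replace f a) (project f R r)
project f (sdq a R) (false , r) = sdq a (project f R r)

project-unit : ∀ f X x → kept (summaryOf X x) ≡ false → project f X x ≈ ∘
project-unit f ∘ x k = ≈-refl
project-unit f (at a) true ()
project-unit f (at a) false k = ≈-refl
project-unit f (neg a) true ()
project-unit f (neg a) false k = ≈-refl
project-unit f (par R T) (r , t) k =
  ≈-trans (par-cong (project-unit f R r (∨-falseˡ k)) (project-unit f T t (∨-falseʳ {kept (summaryOf R r)} k))) par-unitˡ
project-unit f (copar R T) (r , t) k =
  ≈-trans (copar-cong (project-unit f R r (∨-falseˡ k)) (project-unit f T t (∨-falseʳ {kept (summaryOf R r)} k))) copar-unitˡ
project-unit f (seq R T) (r , t) k =
  ≈-trans (seq-cong (project-unit f R r (∨-falseˡ k)) (project-unit f T t (∨-falseʳ {kept (summaryOf R r)} k))) seq-unitˡ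
project-unit f (sdq a R) (true , r) k = rename-cong (replace f a) (project-unit f R r k)
project-unit f (sdq a R) (false , r) k = ≈-trans (sdq-cong (project-unit f R r k)) (sdq-vac (λ ()))

project-fn : ∀ f X x {n} → n ∈fn project f X x → n ∈fn X ⊎ n ≡ f
project-fn f (at a) true fn-at = inj₁ fn-at
project-fn f (neg a) true fn-neg = inj₁ fn-neg
project-fn f (par R T) (r , t) (fn-parˡ p) = map₁ fn-parˡ (project-fn f R r p)
project-fn f (par R T) (r , t) (fn-parʳ p) = map₁ fn-parʳ (project-fn f T t p)
project-fn f (copar R T) (r , t) (fn-coparˡ p) = map₁ fn-coparˡ (project-fn f R r p)
project-fn f (copar R T) (r , t) (fn-coparʳ p) = map₁ fn-coparʳ (project-fn f T t p)
project-fn f (seq R T) (r , t) (fn-seqˡ p) = map₁ fn-seqˡ (project-fn f R r p)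
project-fn f (seq R T) (r , t) (fn-seqʳ p) = map₁ fn-seqʳ (project-fn f T t p)
project-fn f (sdq a R) (false , r) (fn-sdq ne p) = map₁ (fn-sdq ne) (project-fn f R r p)
project-fn f (sdq a R) (true , r) p with renaming-fn⁻ (rename-renaming (replace f a) (project f R r)) p
... | k , q , e with k ≟ a
...   | yes refl = inj₂ (trans (sym e) (replace-≡ f a))
...   | no k≢a with project-fn f R r q
...     | inj₁ q' = inj₁ (subst (_∈fn sdq a R) (trans (sym (replace-≢ f a k≢a)) e) (fn-sdq k≢a q'))
...     | inj₂ k≡f = inj₂ (trans (sym e) (trans (replace-≢ f a k≢a) k≡f))

annot-along : ∀ {σ X Y} → Renaming σ X Y → Annot X → Annot Y
annot-along ren-∘ x = x
annot-along ren-at x = x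
annot-along ren-neg x = x
annot-along (ren-par r t) (x , y) = annot-along r x , annot-along t y
annot-along (ren-copar r t) (x , y) = annot-along r x , annot-along t y
annot-along (ren-seq r t) (x , y) = annot-along r x , annot-along t y
annot-along (ren-sdq _ r) (i , x) = i , annot-along r x

annot-back : ∀ {σ X Y} → Renaming σ X Y → Annot Y → Annot X
annot-back ren-∘ y = y
annot-back ren-at y = y
annot-back ren-neg y = y
annot-back (ren-par r t) (x , y) = annot-back r x , annot-back t y
annot-back (ren-copar r t) (x , y) = annot-back r x , annot-back t y
annot-back (ren-seq r t) (x , y) = annot-back r x , annot-back t y
annot-back (ren-sdq _ r) (i , y) = i , annot-back r y

annot-along-back : ∀ {σ X Y} (r : Renaming σ X Y) y → annot-along r (annot-back r y) ≡ y
annot-along-back ren-∘ y = refl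
annot-along-back ren-at y = refl
annot-along-back ren-neg y = refl
annot-along-back (ren-par r t) (x , y) = cong₂ _,_ (annot-along-back r x) (annot-along-back t y)
annot-along-back (ren-copar r t) (x , y) = cong₂ _,_ (annot-along-back r x) (annot-along-back t y)
annot-along-back (ren-seq r t) (x , y) = cong₂ _,_ (annot-along-back r x) (annot-along-back t y)
annot-along-back (ren-sdq _ r) (i , y) = cong (i ,_) (annot-along-back r y)

summary-along : ∀ {σ X Y} (r : Renaming σ X Y) x → summaryOf Y (annot-along r x) ≡ summaryOf X x
summary-along ren-∘ x = refl
summary-along ren-at x = refl
summary-along ren-neg x = refl
summary-along (ren-par r t) (x , y) = cong₂ _⊕_ (summary-along r x) (summary-along t y)
summary-along (ren-copar r t) (x , y) = cong₂ _⊕_ (summary-along r x) (summary-along t y)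
summary-along (ren-seq r t) (x , y) = cong₂ _⊕_ (summary-along r x) (summary-along t y)
summary-along (ren-sdq _ r) (i , x) = cong (underSdq i) (summary-along r x)

summary-back : ∀ {σ X Y} (r : Renaming σ X Y) y → summaryOf X (annot-back r y) ≡ summaryOf Y y
summary-back ren-∘ y = refl
summary-back ren-at y = refl
summary-back ren-neg y = refl
summary-back (ren-par r t) (x , y) = cong₂ _⊕_ (summary-back r x) (summary-back t y)
summary-back (ren-copar r t) (x , y) = cong₂ _⊕_ (summary-back r x) (summary-back t y)
summary-back (ren-seq r t) (x , y) = cong₂ _⊕_ (summary-back r x) (summary-back t y)
summary-back (ren-sdq _ r) (i , y) = cong (underSdq i) (summary-back r y)

consistent-along : ∀ {σ X Y} (r : Renaming σ X Y) x → Consistent X x → Consistent Y (annot-along r x)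
consistent-along ren-∘ x c = c
consistent-along ren-at x c = c
consistent-along ren-neg x c = c
consistent-along (ren-par r t) (x , y) (cx , cy , cc) =
  consistent-along r x cx , consistent-along t y cy ,
  subst₂ Compatible (sym (summary-along r x)) (sym (summary-along t y)) cc
consistent-along (ren-copar r t) (x , y) (cx , cy) = consistent-along r x cx , consistent-along t y cy
consistent-along (ren-seq r t) (x , y) (cx , cy) = consistent-along r x cx , consistent-along t y cy
consistent-along (ren-sdq _ r) (i , x) c = consistent-along r x c

consistent-back : ∀ {σ X Y} (r : Renaming σ X Y) y → Consistent Y y → Consistent X (annot-back r y)
consistent-back ren-∘ y c = c
consistent-back ren-at y c = c
consistent-back ren-neg y c = c
consistent-back (ren-par r t) (x , y) (cx , cy , cc) =
  consistent-back r x cx , consistent-back t y cy ,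
  subst₂ Compatible (sym (summary-back r x)) (sym (summary-back t y)) cc
consistent-back (ren-copar r t) (x , y) (cx , cy) = consistent-back r x cx , consistent-back t y cy
consistent-back (ren-seq r t) (x , y) (cx , cy) = consistent-back r x cx , consistent-back t y cy
consistent-back (ren-sdq _ r) (i , y) c = consistent-back r y c

project-renaming : ∀ f {σ X Y} (r : Renaming σ X Y) → σ f ≡ f → maxN X < f → maxN Y < f →
                   ∀ x → project f Y (annot-along r x) ≈ rename σ (project f X x)
project-renaming f ren-∘ σf bX bY x = ≈-refl
project-renaming f ren-at σf bX bY true = ≈-refl
project-renaming f ren-at σf bX bY false = ≈-refl
project-renaming f ren-neg σf bX bY true = ≈-refl
project-renaming f ren-neg σf bX bY false = ≈-refl
project-renaming f (ren-par r t) σf bX bY (x , y) =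
  par-cong (project-renaming f r σf (m⊔n<o⇒m<o _ _ bX) (m⊔n<o⇒m<o _ _ bY) x)
           (project-renaming f t σf (m⊔n<o⇒n<o _ _ bX) (m⊔n<o⇒n<o _ _ bY) y)
project-renaming f (ren-copar r t) σf bX bY (x , y) =
  copar-cong (project-renaming f r σf (m⊔n<o⇒m<o _ _ bX) (m⊔n<o⇒m<o _ _ bY) x)
             (project-renaming f t σf (m⊔n<o⇒n<o _ _ bX) (m⊔n<o⇒n<o _ _ bY) y)
project-renaming f (ren-seq r t) σf bX bY (x , y) =
  seq-cong (project-renaming f r σf (m⊔n<o⇒m<o _ _ bX) (m⊔n<o⇒m<o _ _ bY) x)
           (project-renaming f t σf (m⊔n<o⇒n<o _ _ bX) (m⊔n<o⇒n<o _ _ bY) y)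
project-renaming f {σ} (ren-sdq {c = c} {c' = c'} {R = R} {R' = R'} fr r) σf bX bY (i , x) = by-mark i
  where
  c≢f : c ≢ f
  c≢f = <⇒≢ (m⊔n<o⇒m<o _ _ bX)
  c'≢f : c' ≢ f
  c'≢f = <⇒≢ (m⊔n<o⇒m<o _ _ bY)
  body : project f R' (annot-along r x) ≈ rename (update σ c c') (project f R x)
  body = project-renaming f r (trans (update-≢ σ c' (λ e → c≢f (sym e))) σf)
                          (m⊔n<o⇒n<o _ _ bX) (m⊔n<o⇒n<o _ _ bY) x
  fr' : ∀ n → n ∈fn project f R x → n ≢ c → σ n ≢ c'
  fr' n p ne with project-fn f R x p
  ... | inj₁ q = fr n q ne
  ... | inj₂ refl = λ e → c'≢f (trans (sym e) σf)
  ag : Agree (replace f c' ∘ᶠ update σ c c') (σ ∘ᶠ replace f c) (project f R x)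
  ag n p with n ≟ c
  ... | yes refl = trans (cong (replace f c') (update-≡ σ n c'))
                     (trans (replace-≡ f c') (trans (sym σf) (cong σ (sym (replace-≡ f n)))))
  ... | no ne with project-fn f R x p
  ...   | inj₁ q = trans (cong (replace f c') (update-≢ σ c' ne))
                     (trans (replace-≢ f c' (fr n q ne)) (cong σ (sym (replace-≢ f c ne))))
  ...   | inj₂ refl = trans (cong (replace f c') (trans (update-≢ σ c' ne) σf))
                        (trans (replace-≢ f c' (λ e → c'≢f (sym e))) (trans (sym σf) (cong σ (sym (replace-≢ f c ne)))))
  by-mark : ∀ i → project f (sdq c' R') (annot-along (ren-sdq fr r) (i , x)) ≈ rename σ (project f (sdq c R) (i , x))
  by-mark false = ≈-trans (sdq-cong body)
                    (renaming-unique _ (ren-sdq fr' (rename-renaming _ _)) (rename-renaming σ _))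
  by-mark true = ≈-trans (rename-cong (replace f c') body)
                   (≈-trans (rename-comp _ _ _) (≈-trans (rename-agree _ ag) (≈-sym (rename-comp _ _ _))))

Reflects : Name → Str → Str → Set
Reflects f P Q = ∀ y → Consistent Q y →
  Σ[ x ∈ Annot P ] Consistent P x × summaryOf P x ≼ summaryOf Q y × project f P x ≈ project f Q y

reflects-refl : ∀ {f P} → Reflects f P P
reflects-refl y c = y , c , ≼-refl , ≈-refl

reflects-trans : ∀ {f P T U} → Reflects f P T → Reflects f T U → Reflects f P U
reflects-trans PT TU y c =
  let (z , cz , lz , ez) = TU y c
      (x , cx , lx , ex) = PT z cz
  in x , cx , ≼-trans lx lz , ≈-trans ex ez

-- Summaries only shrink, so compatibility of a par is inherited.
reflects-par : ∀ {f R R' T T'} → Reflects f R R' → Reflects f T T' → Reflects f (par R T) (par R' T')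
reflects-par RR' TT' (y₁ , y₂) (c₁ , c₂ , cc) =
  let (x₁ , cx₁ , l₁ , e₁) = RR' y₁ c₁
      (x₂ , cx₂ , l₂ , e₂) = TT' y₂ c₂
  in (x₁ , x₂) , (cx₁ , cx₂ , compatible-≼ l₁ l₂ cc) , ≼-⊕ l₁ l₂ , par-cong e₁ e₂

reflects-copar : ∀ {f R R' T T'} → Reflects f R R' → Reflects f T T' → Reflects f (copar R T) (copar R' T')
reflects-copar RR' TT' (y₁ , y₂) (c₁ , c₂) =
  let (x₁ , cx₁ , l₁ , e₁) = RR' y₁ c₁
      (x₂ , cx₂ , l₂ , e₂) = TT' y₂ c₂
  in (x₁ , x₂) , (cx₁ , cx₂) , ≼-⊕ l₁ l₂ , copar-cong e₁ e₂

reflects-seq : ∀ {f R R' T T'} → Reflects f R R' → Reflects f T T' → Reflects f (seq R T) (seq R' T')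
reflects-seq RR' TT' (y₁ , y₂) (c₁ , c₂) =
  let (x₁ , cx₁ , l₁ , e₁) = RR' y₁ c₁
      (x₂ , cx₂ , l₂ , e₂) = TT' y₂ c₂
  in (x₁ , x₂) , (cx₁ , cx₂) , ≼-⊕ l₁ l₂ , seq-cong e₁ e₂

reflects-sdq : ∀ {f a R R'} → Reflects f R R' → Reflects f (sdq a R) (sdq a R')
reflects-sdq {f} {a} RR' (i , y) c =
  let (x , cx , l , e) = RR' y c
  in (i , x) , cx , underSdq-mono i l , by-mark i e
  where
  by-mark : ∀ i {R R' x y} → project f R x ≈ project f R' y → project f (sdq a R) (i , x) ≈ project f (sdq a R') (i , y)
  by-mark true e = rename-cong (replace f a) e
  by-mark false e = sdq-cong e

reflects-par-assoc : ∀ {f R T U} → Reflects f (par (par R T) U) (par R (par T U)) × Reflects f (par R (par T U)) (par (par R T) U)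
reflects-par-assoc {R = R} =
  (λ { (r , (t , u)) (cr , (ct , cu , ctu) , crtu) →
       let (c₁ , c₂) = compatible-assoc' ctu crtu in
       ((r , t) , u) , ((cr , ct , c₁) , cu , c₂) , ≼-reflexive (⊕-assoc (summaryOf R r) _ _) , par-assoc }) ,
  (λ { ((r , t) , u) ((cr , ct , c₁) , cu , c₂) →
       let (ctu , crtu) = compatible-assoc c₁ c₂ in
       (r , (t , u)) , (cr , (ct , cu , ctu) , crtu) , ≼-reflexive (sym (⊕-assoc (summaryOf R r) _ _)) , ≈-sym par-assoc })

-- Vacuous quantifiers: an instantiated one projects like its body.
reflects-sdq-vac : ∀ {f a R} → a ∉fn R → a ≢ f → Reflects f (sdq a R) R × Reflects f R (sdq a R)
reflects-sdq-vac {f} {a} {R} a∉R a≢f = drop , add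
  where
  a∉proj : ∀ y → a ∉fn project f R y
  a∉proj y p with project-fn f R y p
  ... | inj₁ q = a∉R q
  ... | inj₂ e = a≢f e
  ag : ∀ y → Agree (replace f a) idᶠ (project f R y)
  ag y n p with project-fn f R y p
  ... | inj₁ q = replace-≢ f a (λ e → a∉R (subst (_∈fn R) e q))
  ... | inj₂ refl = replace-≢ f a (λ e → a≢f (sym e))
  drop : Reflects f (sdq a R) R
  drop y c = (false , y) , c , ≼-refl , sdq-vac (a∉proj y)
  add : Reflects f R (sdq a R)
  add (true , y) c = y , c , underSdq-≽ true , ≈-sym (rename-id (project f R y) (ag y))
  add (false , y) c = y , c , ≼-refl , ≈-sym (sdq-vac (a∉proj y))

-- α-conversion: annotations are carried along the renaming R ↦ R{b/a}.
reflects-sdq-alpha : ∀ {f a b R} → b ∉fn R → maxN (sdq a R) < f → maxN (sdq b (R [ b / a ])) < f →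
                     Reflects f (sdq a R) (sdq b (R [ b / a ])) × Reflects f (sdq b (R [ b / a ])) (sdq a R)
reflects-sdq-alpha {f} {a} {b} {R} b∉R bL bR = back , forth
  where
  ren = rename-renaming (replace b a) R
  a≢f : a ≢ f
  a≢f = <⇒≢ (m⊔n<o⇒m<o _ _ bL)
  b≢f : b ≢ f
  b≢f = <⇒≢ (m⊔n<o⇒m<o _ _ bR)
  proj-ren : ∀ r → project f (R [ b / a ]) (annot-along ren r) ≈ rename (replace b a) (project f R r)
  proj-ren r = project-renaming f ren (replace-≢ b a (λ e → a≢f (sym e))) (m⊔n<o⇒n<o _ _ bL) (m⊔n<o⇒n<o _ _ bR) r
  b∉proj : ∀ r → b ∉fn project f R r
  b∉proj r p with project-fn f R r p
  ... | inj₁ q = b∉R q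
  ... | inj₂ e = b≢f e
  ag : ∀ r → Agree (replace f b ∘ᶠ replace b a) (replace f a) (project f R r)
  ag r n p with n ≟ a
  ... | yes refl = trans (cong (replace f b) (replace-≡ b n)) (trans (replace-≡ f b) (sym (replace-≡ f n)))
  ... | no ne = trans (cong (replace f b) (replace-≢ b a ne)) (trans (replace-≢ f b n≢b) (sym (replace-≢ f a ne)))
    where
    n≢b : n ≢ b
    n≢b e with project-fn f R r p
    ... | inj₁ q = b∉R (subst (_∈fn R) e q)
    ... | inj₂ e' = b≢f (trans (sym e) e')
  alpha : ∀ i r → project f (sdq a R) (i , r) ≈ project f (sdq b (R [ b / a ])) (i , annot-along ren r)
  alpha false r = ≈-trans (sdq-alpha (b∉proj r)) (sdq-cong (≈-sym (proj-ren r)))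
  alpha true r = ≈-sym (≈-trans (rename-cong (replace f b) (proj-ren r))
                          (≈-trans (rename-comp _ _ _) (rename-agree _ (ag r))))
  forth : Reflects f (sdq b (R [ b / a ])) (sdq a R)
  forth (i , r) c =
    (i , annot-along ren r) , consistent-along ren r c ,
    ≼-reflexive (cong (underSdq i) (summary-along ren r)) , ≈-sym (alpha i r)
  back : Reflects f (sdq a R) (sdq b (R [ b / a ]))
  back (i , u) c =
    (i , annot-back ren u) , consistent-back ren u c ,
    ≼-reflexive (cong (underSdq i) (summary-back ren u)) ,
    subst (λ z → project f (sdq a R) (i , annot-back ren u) ≈ project f (sdq b (R [ b / a ])) (i , z))
          (annot-along-back ren u) (alpha i (annot-back ren u))

-- Swapping quantifiers: instantiations by f commute with each other and with
-- the remaining quantifier.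
reflects-sdq-swap : ∀ {f a b R} → maxN (sdq a (sdq b R)) < f →
                    Reflects f (sdq a (sdq b R)) (sdq b (sdq a R)) × Reflects f (sdq b (sdq a R)) (sdq a (sdq b R))
reflects-sdq-swap {f} {a} {b} {R} bnd with a ≟ b
... | yes refl = reflects-refl {P = sdq a (sdq a R)} , reflects-refl {P = sdq a (sdq a R)}
... | no a≢b = back , forth
  where
  a≢f : a ≢ f
  a≢f = <⇒≢ (m⊔n<o⇒m<o _ _ bnd)
  b≢f : b ≢ f
  b≢f = <⇒≢ (m⊔n<o⇒m<o _ _ (m⊔n<o⇒n<o a _ bnd))
  inst-past : ∀ c d Z → c ≢ d → d ≢ f → rename (replace f c) (sdq d Z) ≈ sdq d (rename (replace f c) Z)
  inst-past c d Z c≢d d≢f = rename-sdq-fixed (replace f c) d Z (replace-≢ f c (λ e → c≢d (sym e))) fr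
    where
    fr : ∀ n → n ∈fn Z → n ≢ d → replace f c n ≢ d
    fr n p nd with n ≟ c
    ... | yes refl = subst (_≢ d) (sym (replace-≡ f n)) (λ e → d≢f (sym e))
    ... | no nc = subst (_≢ d) (sym (replace-≢ f c nc)) nd
  inst-both : ∀ Z → Agree (replace f a ∘ᶠ replace f b) (replace f b ∘ᶠ replace f a) Z
  inst-both Z n p with n ≟ a | n ≟ b
  ... | yes refl | yes refl = ⊥-elim (a≢b refl)
  ... | yes refl | no nb = trans (cong (replace f n) (replace-≢ f b nb))
                             (trans (replace-≡ f n) (sym (trans (cong (replace f b) (replace-≡ f n)) (replace-≢ f b (λ e → b≢f (sym e))))))
  ... | no na | yes refl = trans (cong (replace f a) (replace-≡ f n))
                             (trans (replace-≢ f a (λ e → a≢f (sym e))) (sym (trans (cong (replace f n) (replace-≢ f a na)) (replace-≡ f n))))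
  ... | no na | no nb = trans (cong (replace f a) (replace-≢ f b nb))
                          (trans (replace-≢ f a na) (sym (trans (cong (replace f b) (replace-≢ f a na)) (replace-≢ f b nb))))
  swapped : ∀ i₁ i₂ r → project f (sdq a (sdq b R)) (i₁ , (i₂ , r)) ≈ project f (sdq b (sdq a R)) (i₂ , (i₁ , r))
  swapped false false r = sdq-swap
  swapped true false r = inst-past a b _ a≢b b≢f
  swapped false true r = ≈-sym (inst-past b a _ (λ e → a≢b (sym e)) a≢f)
  swapped true true r =
    ≈-trans (rename-comp _ _ _) (≈-trans (rename-agree _ (inst-both (project f R r))) (≈-sym (rename-comp _ _ _)))
  back : Reflects f (sdq a (sdq b R)) (sdq b (sdq a R))
  back (i₂ , (i₁ , r)) c = (i₁ , (i₂ , r)) , c , underSdq-swap i₁ i₂ _ , swapped i₁ i₂ r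
  forth : Reflects f (sdq b (sdq a R)) (sdq a (sdq b R))
  forth (i₁ , (i₂ , r)) c = (i₂ , (i₁ , r)) , c , underSdq-swap i₂ i₁ _ , ≈-sym (swapped i₁ i₂ r)

maxN≈ : ∀ {P Q} → P ≈ Q → ℕ
maxN≈-steps : ∀ {P Q} → P ≈ Q → ℕ
maxN≈ {P} {Q} e = maxN P ⊔ maxN Q ⊔ maxN≈-steps e
maxN≈-steps (≈-sym e) = maxN≈ e
maxN≈-steps (≈-trans e e') = maxN≈ e ⊔ maxN≈ e'
maxN≈-steps (par-cong e e') = maxN≈ e ⊔ maxN≈ e'
maxN≈-steps (copar-cong e e') = maxN≈ e ⊔ maxN≈ e'
maxN≈-steps (seq-cong e e') = maxN≈ e ⊔ maxN≈ e'
maxN≈-steps (sdq-cong e) = maxN≈ e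
maxN≈-steps _ = 0

module _ {P Q f} (e : P ≈ Q) (lt : maxN≈ e < f) where
  fresh-lhs : maxN P < f
  fresh-lhs = m⊔n<o⇒m<o (maxN P) (maxN Q) (m⊔n<o⇒m<o (maxN P ⊔ maxN Q) (maxN≈-steps e) lt)
  fresh-rhs : maxN Q < f
  fresh-rhs = m⊔n<o⇒n<o (maxN P) (maxN Q) (m⊔n<o⇒m<o (maxN P ⊔ maxN Q) (maxN≈-steps e) lt)
  fresh-steps : maxN≈-steps e < f
  fresh-steps = m⊔n<o⇒n<o (maxN P ⊔ maxN Q) (maxN≈-steps e) lt

fresh-both : ∀ {P Q P' Q' f} (e : P ≈ Q) (e' : P' ≈ Q') → maxN≈ e ⊔ maxN≈ e' < f → maxN≈ e < f × maxN≈ e' < f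
fresh-both e e' lt = m⊔n<o⇒m<o (maxN≈ e) (maxN≈ e') lt , m⊔n<o⇒n<o (maxN≈ e) (maxN≈ e') lt

≈-reflects : ∀ {P Q} (e : P ≈ Q) f → maxN≈ e < f → Reflects f P Q × Reflects f Q P
≈-reflects ≈-refl f lt = reflects-refl , reflects-refl
≈-reflects (≈-sym e) f lt = swap (≈-reflects e f (fresh-steps (≈-sym e) lt))
≈-reflects (≈-trans e e') f lt =
  let (lt₁ , lt₂) = fresh-both e e' (fresh-steps (≈-trans e e') lt)
      (PT , TP) = ≈-reflects e f lt₁
      (TU , UT) = ≈-reflects e' f lt₂
  in reflects-trans PT TU , reflects-trans UT TP
≈-reflects (par-cong e e') f lt =
  let (lt₁ , lt₂) = fresh-both e e' (fresh-steps (par-cong e e') lt)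
      (RR' , R'R) = ≈-reflects e f lt₁
      (TT' , T'T) = ≈-reflects e' f lt₂
  in reflects-par RR' TT' , reflects-par R'R T'T
≈-reflects (copar-cong e e') f lt =
  let (lt₁ , lt₂) = fresh-both e e' (fresh-steps (copar-cong e e') lt)
      (RR' , R'R) = ≈-reflects e f lt₁
      (TT' , T'T) = ≈-reflects e' f lt₂
  in reflects-copar RR' TT' , reflects-copar R'R T'T
≈-reflects (seq-cong e e') f lt =
  let (lt₁ , lt₂) = fresh-both e e' (fresh-steps (seq-cong e e') lt)
      (RR' , R'R) = ≈-reflects e f lt₁
      (TT' , T'T) = ≈-reflects e' f lt₂
  in reflects-seq RR' TT' , reflects-seq R'R T'T
≈-reflects (sdq-cong {a} {R} {R'} e) f lt =
  let (RR' , R'R) = ≈-reflects e f (fresh-steps (sdq-cong {a} {R} {R'} e) lt)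
  in reflects-sdq RR' , reflects-sdq R'R
≈-reflects par-assoc f lt = reflects-par-assoc
≈-reflects (copar-assoc {R}) f lt =
  (λ { (r , (t , u)) (cr , (ct , cu)) →
       ((r , t) , u) , ((cr , ct) , cu) , ≼-reflexive (⊕-assoc (summaryOf R r) _ _) , copar-assoc }) ,
  (λ { ((r , t) , u) ((cr , ct) , cu) →
       (r , (t , u)) , (cr , (ct , cu)) , ≼-reflexive (sym (⊕-assoc (summaryOf R r) _ _)) , ≈-sym copar-assoc })
≈-reflects (seq-assoc {R}) f lt =
  (λ { (r , (t , u)) (cr , (ct , cu)) →
       ((r , t) , u) , ((cr , ct) , cu) , ≼-reflexive (⊕-assoc (summaryOf R r) _ _) , seq-assoc }) ,
  (λ { ((r , t) , u) ((cr , ct) , cu) →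
       (r , (t , u)) , (cr , (ct , cu)) , ≼-reflexive (sym (⊕-assoc (summaryOf R r) _ _)) , ≈-sym seq-assoc })
≈-reflects (par-comm {R} {T}) f lt =
  (λ { (t , r) (ct , cr , c) → (r , t) , (cr , ct , compatible-comm c) , ≼-reflexive (⊕-comm (summaryOf R r) _) , par-comm }) ,
  (λ { (r , t) (cr , ct , c) → (t , r) , (ct , cr , compatible-comm c) , ≼-reflexive (⊕-comm (summaryOf T t) _) , par-comm })
≈-reflects (copar-comm {R} {T}) f lt =
  (λ { (t , r) (ct , cr) → (r , t) , (cr , ct) , ≼-reflexive (⊕-comm (summaryOf R r) _) , copar-comm }) ,
  (λ { (r , t) (cr , ct) → (t , r) , (ct , cr) , ≼-reflexive (⊕-comm (summaryOf T t) _) , copar-comm })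
≈-reflects par-unitˡ f lt =
  (λ y c → (tt , y) , (tt , c , inj₁ (refl , refl , refl)) , ≼-refl , par-unitˡ) ,
  (λ { (_ , y) (_ , c , _) → y , c , ≼-refl , ≈-sym par-unitˡ })
≈-reflects par-unitʳ f lt =
  (λ y c → (y , tt) , (c , tt , inj₂ (inj₁ (refl , refl , refl))) , ≼-reflexive (⊕-identityʳ _) , par-unitʳ) ,
  (λ { (y , _) (c , _ , _) → y , c , ≼-reflexive (sym (⊕-identityʳ _)) , ≈-sym par-unitʳ })
≈-reflects copar-unitˡ f lt =
  (λ y c → (tt , y) , (tt , c) , ≼-refl , copar-unitˡ) ,
  (λ { (_ , y) (_ , c) → y , c , ≼-refl , ≈-sym copar-unitˡ })
≈-reflects copar-unitʳ f lt =
  (λ y c → (y , tt) , (c , tt) , ≼-reflexive (⊕-identityʳ _) , copar-unitʳ) ,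
  (λ { (y , _) (c , _) → y , c , ≼-reflexive (sym (⊕-identityʳ _)) , ≈-sym copar-unitʳ })
≈-reflects seq-unitˡ f lt =
  (λ y c → (tt , y) , (tt , c) , ≼-refl , seq-unitˡ) ,
  (λ { (_ , y) (_ , c) → y , c , ≼-refl , ≈-sym seq-unitˡ })
≈-reflects seq-unitʳ f lt =
  (λ y c → (y , tt) , (c , tt) , ≼-reflexive (⊕-identityʳ _) , seq-unitʳ) ,
  (λ { (y , _) (c , _) → y , c , ≼-reflexive (sym (⊕-identityʳ _)) , ≈-sym seq-unitʳ })
≈-reflects (sdq-vac a∉R) f lt = reflects-sdq-vac a∉R (<⇒≢ (m⊔n<o⇒m<o _ _ (fresh-lhs (sdq-vac a∉R) lt)))
≈-reflects (sdq-alpha b∉R) f lt = reflects-sdq-alpha b∉R (fresh-lhs (sdq-alpha b∉R) lt) (fresh-rhs (sdq-alpha b∉R) lt)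
≈-reflects (sdq-swap {a} {b} {R}) f lt = reflects-sdq-swap (fresh-lhs (sdq-swap {a} {b} {R}) lt)

StepReflects : Name → Str → Str → Set
StepReflects f P Q = ∀ y → Consistent Q y →
  Σ[ x ∈ Annot P ] Consistent P x × summaryOf P x ≼ summaryOf Q y × project f P x ⇝ project f Q y

mixed-incompatible : ¬ Compatible (colour true) (colour false)
mixed-incompatible (inj₁ (() , _))
mixed-incompatible (inj₂ (inj₁ (_ , () , _)))
mixed-incompatible (inj₂ (inj₂ (inj₁ (() , _) , _)))
mixed-incompatible (inj₂ (inj₂ (inj₂ (_ , ()) , _)))

instantiated-compatible : ∀ {w u} → Compatible (underSdq true w) u → kept w ≡ false ⊎ Empty u
instantiated-compatible (inj₁ (k , _)) = inj₁ k
instantiated-compatible (inj₂ (inj₁ eu)) = inj₂ eu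
instantiated-compatible {w} (inj₂ (inj₂ (_ , m , _))) = inj₁ (∨-falseˡ (∨-falseˡ {kept w ∨ erased w} m))

both-unit : ∀ {A B} → A ≈ ∘ → B ≈ ∘ → A ≈ B
both-unit a b = ≈-trans a (≈-sym b)

-- The medial rule for quantifiers: when only one side is instantiated, that
-- side or its partner projects to the unit, so no rule is needed.
u↓-reflects : ∀ f a R U → StepReflects f (sdq a (par R U)) (par (sdq a R) (sdq a U))
u↓-reflects f a R U ((i₁ , r) , (i₂ , u)) (cr , cu , cc) = by-marks i₁ i₂ cc
  where
  sR = summaryOf R r
  sU = summaryOf U u
  PR = project f R r
  PU = project f U u
  Result : Bool → Bool → Set
  Result i₁ i₂ = Σ[ x ∈ Annot (sdq a (par R U)) ] Consistent (sdq a (par R U)) x ×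
    summaryOf (sdq a (par R U)) x ≼ underSdq i₁ sR ⊕ underSdq i₂ sU ×
    project f (sdq a (par R U)) x ⇝ par (project f (sdq a R) (i₁ , r)) (project f (sdq a U) (i₂ , u))
  cons : ∀ {i₁ i₂} → Compatible (underSdq i₁ sR) (underSdq i₂ sU) → Consistent (par R U) (r , u)
  cons {i₁} {i₂} cc = cr , cu , compatible-≼ (underSdq-≽ i₁ {sR}) (underSdq-≽ i₂ {sU}) cc
  body-≼ : ∀ i₁ i₂ → sR ⊕ sU ≼ underSdq i₁ sR ⊕ underSdq i₂ sU
  body-≼ i₁ i₂ = ≼-⊕ (underSdq-≽ i₁ {sR}) (underSdq-≽ i₂ {sU})
  by-marks : ∀ i₁ i₂ → Compatible (underSdq i₁ sR) (underSdq i₂ sU) → Result i₁ i₂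
  by-marks false false cc = (false , (r , u)) , cons cc , body-≼ false false , rule-⇝ (u↓ a _ _)
  by-marks true true cc = (true , (r , u)) , cons cc , underSdq-⊕ sR sU , inj₁ ≈-refl
  by-marks true false cc with instantiated-compatible cc
  ... | inj₁ kR = (false , (r , u)) , cons cc , body-≼ true false ,
    inj₁ (≈-trans (sdq-cong (≈-trans (par-cong (project-unit f R r kR) ≈-refl) par-unitˡ))
                  (≈-sym (≈-trans (par-cong (project-unit f (sdq a R) (true , r) kR) ≈-refl) par-unitˡ)))
  ... | inj₂ eU = (true , (r , u)) , cons cc ,
    ≼-trans (underSdq-⊕ sR sU) (≼-⊕ ≼-refl (underSdq-empty true eU)) ,
    inj₁ (par-cong ≈-refl (both-unit (project-unit f (sdq a U) (true , u) (proj₁ eU))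
                                     (project-unit f (sdq a U) (false , u) (proj₁ eU))))
  by-marks false true cc with instantiated-compatible (compatible-comm cc)
  ... | inj₁ kU = (false , (r , u)) , cons cc , body-≼ false true ,
    inj₁ (≈-trans (sdq-cong (≈-trans (par-cong ≈-refl (project-unit f U u kU)) par-unitʳ))
                  (≈-sym (≈-trans (par-cong ≈-refl (project-unit f (sdq a U) (true , u) kU)) par-unitʳ)))
  ... | inj₂ eR = (true , (r , u)) , cons cc ,
    ≼-trans (underSdq-⊕ sR sU) (≼-⊕ (underSdq-empty true eR) ≼-refl) ,
    inj₁ (par-cong (both-unit (project-unit f (sdq a R) (true , r) (proj₁ eR))
                              (project-unit f (sdq a R) (false , r) (proj₁ eR))) ≈-refl)

rule-reflects : ∀ f {P Q} → Rule P Q → StepReflects f P Q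
rule-reflects f (ai↓ a) (true , true) _ = tt , tt , ∅≼ , rule-⇝ (ai↓ a)
rule-reflects f (ai↓ a) (false , false) _ = tt , tt , ∅≼ , inj₁ (≈-sym par-unitˡ)
rule-reflects f (ai↓ a) (true , false) (_ , _ , cc) = ⊥-elim (mixed-incompatible cc)
rule-reflects f (ai↓ a) (false , true) (_ , _ , cc) = ⊥-elim (mixed-incompatible (compatible-comm cc))
rule-reflects f (s R T U) ((r , t) , u) ((cr , ct) , cu , cc) =
  ((r , u) , t) , ((cr , cu , compatible-≼ ≼-⊕ˡ ≼-refl cc) , ct) ,
  ≼-reflexive (⊕-swap₂₃ (summaryOf R r) (summaryOf T t) (summaryOf U u)) , rule-⇝ (s _ _ _)
rule-reflects f (q↓ R T U V) ((r , t) , (u , v)) ((cr , ct) , (cu , cv) , cc) =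
  ((r , u) , (t , v)) ,
  ((cr , cu , compatible-≼ ≼-⊕ˡ ≼-⊕ˡ cc) , (ct , cv , compatible-≼ (≼-⊕ʳ {summaryOf R r}) (≼-⊕ʳ {summaryOf U u}) cc)) ,
  ≼-reflexive (⊕-middle (summaryOf R r) (summaryOf T t) (summaryOf U u) (summaryOf V v)) , rule-⇝ (q↓ _ _ _ _)
rule-reflects f (u↓ a R U) y c = u↓-reflects f a R U y c

-- Rule instances inside a context reflect annotations: the context is
-- annotated as in the conclusion, and an instantiated binder renames the step.
ctx-rule-reflects : ∀ f S {P Q} → Rule P Q → StepReflects f (plug S P) (plug S Q)
ctx-rule-reflects f hole r y c = rule-reflects f r y c
ctx-rule-reflects f (parˡ S T) r (y , t) (cy , ct , cc) =
  let (x , cx , l , st) = ctx-rule-reflects f S r y cy in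
  (x , t) , (cx , ct , compatible-≼ l ≼-refl cc) , ≼-⊕ l ≼-refl , ⇝-plug st (parˡ hole (project f T t))
ctx-rule-reflects f (parʳ T S) r (t , y) (ct , cy , cc) =
  let (x , cx , l , st) = ctx-rule-reflects f S r y cy in
  (t , x) , (ct , cx , compatible-≼ ≼-refl l cc) , ≼-⊕ ≼-refl l , ⇝-plug st (parʳ (project f T t) hole)
ctx-rule-reflects f (coparˡ S T) r (y , t) (cy , ct) =
  let (x , cx , l , st) = ctx-rule-reflects f S r y cy in
  (x , t) , (cx , ct) , ≼-⊕ l ≼-refl , ⇝-plug st (coparˡ hole (project f T t))
ctx-rule-reflects f (coparʳ T S) r (t , y) (ct , cy) =
  let (x , cx , l , st) = ctx-rule-reflects f S r y cy in
  (t , x) , (ct , cx) , ≼-⊕ ≼-refl l , ⇝-plug st (coparʳ (project f T t) hole)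
ctx-rule-reflects f (seqˡ S T) r (y , t) (cy , ct) =
  let (x , cx , l , st) = ctx-rule-reflects f S r y cy in
  (x , t) , (cx , ct) , ≼-⊕ l ≼-refl , ⇝-plug st (seqˡ hole (project f T t))
ctx-rule-reflects f (seqʳ T S) r (t , y) (ct , cy) =
  let (x , cx , l , st) = ctx-rule-reflects f S r y cy in
  (t , x) , (ct , cx) , ≼-⊕ ≼-refl l , ⇝-plug st (seqʳ (project f T t) hole)
ctx-rule-reflects f (sdqᶜ c S) r (true , y) cy =
  let (x , cx , l , st) = ctx-rule-reflects f S r y cy in
  (true , x) , cx , underSdq-mono true l , ⇝-rename st (replace f c)
ctx-rule-reflects f (sdqᶜ c S) r (false , y) cy =
  let (x , cx , l , st) = ctx-rule-reflects f S r y cy in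
  (false , x) , cx , l , ⇝-plug st (sdqᶜ c hole)

maxN⊢ : ∀ {X} → ⊢BVQ X → ℕ
maxN⊢ ax = 0
maxN⊢ (≈-step d e) = maxN⊢ d ⊔ maxN≈ e
maxN⊢ (rule S d r) = maxN⊢ d

⊢-project : ∀ {X} (d : ⊢BVQ X) f → maxN⊢ d < f → (x : Annot X) → Consistent X x → ⊢BVQ (project f X x)
⊢-project ax f lt x c = ax
⊢-project (≈-step d e) f lt x c =
  let (x' , c' , _ , e') = proj₁ (≈-reflects e f (m⊔n<o⇒n<o (maxN⊢ d) _ lt)) x c
  in ≈-step (⊢-project d f (m⊔n<o⇒m<o (maxN⊢ d) _ lt) x' c') e'
⊢-project (rule S d r) f lt x c =
  let (x' , c' , _ , st) = ctx-rule-reflects f S r x c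
  in ⊢-⇝ (⊢-project d f lt x' c') st

paint : Bool → (X : Str) → Annot X
paint k ∘ = tt
paint k (at a) = k
paint k (neg a) = k
paint k (par R T) = paint k R , paint k T
paint k (copar R T) = paint k R , paint k T
paint k (seq R T) = paint k R , paint k T
paint k (sdq a R) = false , paint k R

colour-idem : ∀ k → colour k ⊕ colour k ≡ colour k
colour-idem true = refl
colour-idem false = refl

paint-summary : ∀ k X → summaryOf X (paint k X) ≼ colour k
paint-summary k ∘ = ∅≼
paint-summary k (at a) = ≼-refl
paint-summary k (neg a) = ≼-refl
paint-summary k (par R T) = ≼-trans (≼-⊕ (paint-summary k R) (paint-summary k T)) (≼-reflexive (colour-idem k))
paint-summary k (copar R T) = ≼-trans (≼-⊕ (paint-summary k R) (paint-summary k T)) (≼-reflexive (colour-idem k))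
paint-summary k (seq R T) = ≼-trans (≼-⊕ (paint-summary k R) (paint-summary k T)) (≼-reflexive (colour-idem k))
paint-summary k (sdq a R) = paint-summary k R

monochrome-compatible : ∀ k {w u} → w ≼ colour k → u ≼ colour k → Compatible w u
monochrome-compatible true (_ , e , m) (_ , e' , m') = inj₂ (inj₂ (inj₂ (e refl , e' refl) , m refl , m' refl))
monochrome-compatible false (k , _ , m) (k' , _ , m') = inj₂ (inj₂ (inj₁ (k refl , k' refl) , m refl , m' refl))

paint-consistent : ∀ k X → Consistent X (paint k X)
paint-consistent k ∘ = tt
paint-consistent k (at a) = tt
paint-consistent k (neg a) = tt
paint-consistent k (par R T) =
  paint-consistent k R , paint-consistent k T , monochrome-compatible k (paint-summary k R) (paint-summary k T)
paint-consistent k (copar R T) = paint-consistent k R , paint-consistent k T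
paint-consistent k (seq R T) = paint-consistent k R , paint-consistent k T
paint-consistent k (sdq a R) = paint-consistent k R

project-keep-all : ∀ f X → project f X (paint true X) ≡ X
project-keep-all f ∘ = refl
project-keep-all f (at a) = refl
project-keep-all f (neg a) = refl
project-keep-all f (par R T) = cong₂ par (project-keep-all f R) (project-keep-all f T)
project-keep-all f (copar R T) = cong₂ copar (project-keep-all f R) (project-keep-all f T)
project-keep-all f (seq R T) = cong₂ seq (project-keep-all f R) (project-keep-all f T)
project-keep-all f (sdq a R) = cong (sdq a) (project-keep-all f R)

project-erase-all : ∀ f X → project f X (paint false X) ≈ ∘
project-erase-all f X = project-unit f X (paint false X) (proj₁ (paint-summary false X) refl)

freshFor : ∀ {X} → ⊢BVQ X → ℕ
freshFor {X} d = suc (maxN⊢ d ⊔ maxN X)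

⊢-project-fresh : ∀ {X} (d : ⊢BVQ X) (x : Annot X) → Consistent X x → ⊢BVQ (project (freshFor d) X x)
⊢-project-fresh d = ⊢-project d (freshFor d) (s≤s (m≤m⊔n _ _))

seq-split : ∀ {R T} → ⊢BVQ (seq R T) → ⊢BVQ R × ⊢BVQ T
seq-split {R} {T} d =
  ≈-step (⊢-project-fresh d (paint true R , paint false T) (paint-consistent true R , paint-consistent false T))
         (≈-trans (seq-cong (≡⇒≈ (project-keep-all _ R)) (project-erase-all _ T)) seq-unitʳ) ,
  ≈-step (⊢-project-fresh d (paint false R , paint true T) (paint-consistent false R , paint-consistent true T))
         (≈-trans (seq-cong (project-erase-all _ R) (≡⇒≈ (project-keep-all _ T))) seq-unitˡ)

copar-split : ∀ {R T} → ⊢BVQ (copar R T) → ⊢BVQ R × ⊢BVQ T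
copar-split {R} {T} d =
  ≈-step (⊢-project-fresh d (paint true R , paint false T) (paint-consistent true R , paint-consistent false T))
         (≈-trans (copar-cong (≡⇒≈ (project-keep-all _ R)) (project-erase-all _ T)) copar-unitʳ) ,
  ≈-step (⊢-project-fresh d (paint false R , paint true T) (paint-consistent false R , paint-consistent true T))
         (≈-trans (copar-cong (project-erase-all _ R) (≡⇒≈ (project-keep-all _ T))) copar-unitˡ)

sdq-instantiate : ∀ {a R} → ⊢BVQ (sdq a R) → ∀ b → ⊢BVQ (R [ b / a ])
sdq-instantiate {a} {R} d b = ≈-step (⊢-rename instance-f (replace b f)) f-to-b
  where
  f = freshFor d
  instance-f : ⊢BVQ (rename (replace f a) (project f R (paint true R)))
  instance-f = ⊢-project-fresh d (true , paint true R) (paint-consistent true R)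
  ag : Agree (replace b f ∘ᶠ replace f a) (replace b a) R
  ag n p with n ≟ a
  ... | yes refl = trans (cong (replace b f) (replace-≡ f n)) (trans (replace-≡ b f) (sym (replace-≡ b n)))
  ... | no ne = trans (cong (replace b f) (replace-≢ f a ne)) (trans (replace-≢ b f n≢f) (sym (replace-≢ b a ne)))
    where
    n≢f : n ≢ f
    n≢f = <⇒≢ (s≤s (≤-trans (maxName-fn idᶠ (sdq a R) (fn-sdq ne p)) (m≤n⊔m (maxN⊢ d) _)))
  f-to-b : rename (replace b f) (rename (replace f a) (project f R (paint true R))) ≈ R [ b / a ]
  f-to-b = ≈-trans (rename-cong (replace b f) (rename-cong (replace f a) (≡⇒≈ (project-keep-all f R))))
                   (≈-trans (rename-comp (replace f a) (replace b f) R) (rename-agree R ag))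

seq-intro : ∀ {R T} → ⊢BVQ R × ⊢BVQ T → ⊢BVQ (seq R T)
seq-intro {R} {T} (dR , dT) = ⊢-plug dR (seqˡ hole T) (⊢-plug dT (seqʳ ∘ hole) (⊢-unit (seqʳ ∘ hole) seq-unitˡ))

copar-intro : ∀ {R T} → ⊢BVQ R × ⊢BVQ T → ⊢BVQ (copar R T)
copar-intro {R} {T} (dR , dT) = ⊢-plug dR (coparˡ hole T) (⊢-plug dT (coparʳ ∘ hole) (⊢-unit (coparʳ ∘ hole) copar-unitˡ))

-- One instance with a fresh name suffices, by α-conversion.
sdq-intro : ∀ {a R} → ((b : Name) → ⊢BVQ (R [ b / a ])) → ⊢BVQ (sdq a R)
sdq-intro {a} {R} inst =
  ≈-step (⊢-plug (inst b) (sdqᶜ b hole) (⊢-unit (sdqᶜ b hole) (sdq-vac (λ ()))))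
         (≈-sym (sdq-alpha (fresh-above R ≤-refl)))
  where
  b = suc (maxN R)

mainTheorem4 : (R T : Str) (a : Name) →
    (⊢BVQ (seq R T) ⇔ (⊢BVQ R × ⊢BVQ T))
    × (⊢BVQ (copar R T) ⇔ (⊢BVQ R × ⊢BVQ T))
    × (⊢BVQ (sdq a R) ⇔ ((b : Name) → ⊢BVQ (R [ b / a ])))
mainTheorem4 R T a =
  mk⇔ seq-split seq-intro ,
  mk⇔ copar-split copar-intro ,
  mk⇔ sdq-instantiate sdq-intro
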